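{- Let $\vec{k}$ be any vector of positive integers and let $a$ be a positive integer. Then the polynomial $$\widetilde{C}_{^a\mathcal{K}}(q,t)=\sum_{\pi\in\mathcal{D}_{^a\mathcal{K}}}q^{\mathrm{area}(\pi)}t^{\mathrm{depth}(\pi)}$$ is $q,t$-symmetric, i.e. $\widetilde{C}_{^a\mathcal{K}}(q,t)=\widetilde{C}_{^a\mathcal{K}}(t,q)$.
   Context: For a vector $\vec{k}=(k_1,\dots,k_\ell)$ of positive integers write $\ell(\vec k)=\ell$ and $|\vec k|=k_1+\dots+k_\ell$; put $N=|\vec k|+\ell$. A $\vec{k}$-Dyck path is a word $\pi=\pi_1\pi_2\cdots\pi_N$ consisting of the letters $S^{k_1},S^{k_2},\dots,S^{k_\ell}$, each occurring exactly once and in this order from left to right, together with $|\vec k|$ letters $W$, such that the starting ranks defined by $r_1=0$, $r_{i+1}=r_i+k_j$ if $\pi_i=S^{k_j}$ and $r_{i+1}=r_i-1$ if $\pi_i=W$, are all nonnegative (equivalently, the lattice path from $(0,0)$ to $(N,0)$ with step $(1,k_j)$ for $S^{k_j}$ and $(1,-1)$ for $W$ never goes below the horizontal axis). $\mathcal{D}_{\vec k}$ denotes the set of $\vec k$-Dyck paths. The area sequence is $(a_1,\dots,a_\ell)$ where $a_j=r_i$ for the index $i$ with $\pi_i=S^{k_j}$; $\mathrm{area}(\pi)=a_1+\dots+a_\ell$. Filling algorithm $\eta_*$: consider a tableau with $\ell$ top-justified columns, column $i$ having $k_i+1$ cells (the first row consists of the top cells of all columns). Place the labels $1,2,\dots,N$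 successively: $1$ goes at the top of column $1$; for $i\ge 2$, if $\pi_i$ is an $S$-letter, place $i$ at the top of the leftmost empty column; if $\pi_i=W$, place $i$ immediately below the largest active entry, where an entry is active if it is currently the bottom-most placed entry of its column $j$ and that column does not yet contain $k_j+1$ entries. The result is $\eta_*(\pi)$. Ranking algorithm: given such a filled tableau $F$, assign ranks $0,1,\dots,k_1$ to the cells of column $1$ from top to bottom; for $i=2,\dots,\ell$, if the top entry of column $i$ is $A+1$ and the entry $A$ has rank $\alpha$, assign ranks $\alpha,\alpha+1,\dots,\alpha+k_i$ to column $i$ from top to bottom. The depth labeling sequence $(d_1,\dots,d_\ell)$ of $\pi$ consists of the ranks of the first-row cells of $\eta_*(\pi)$, and $\mathrm{depth}(\pi)=d_1+\dots+d_\ell$. $\mathcal{K}$ denotes the set of all rearrangements of $\vec k$, and for a positive integer $a$, $^a\mathcal{K}=\{(a,j_1,\dots,j_\ell):(j_1,\dots,j_\ell)\in\mathcal{K}\}$. For a set $\mathcal{S}$ of vectors, $\mathcal{D}_{\mathcal{S}}=\bigcup_{\vec j\in\mathcal{S}}\mathcal{D}_{\vec j}$. A polynomial $F(q,t)$ is $q,t$-symmetric if $F(q,t)=F(t,q)$. -}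

module Defs where

open import Data.Nat using (ℕ; zero; suc; _+_; _<_; _≤_; _≟_; _<ᵇ_; _≡ᵇ_; _⊔_)
open import Data.Bool using (Bool; true; false; if_then_else_; _∧_)
open import Data.List using (List; []; _∷_; _++_; [_]; length; map; concatMap; filter; replicate; deduplicate; zipWith; last)
open import Data.List.Properties using (≡-dec)
open import Data.Nat.ListAction using (sum)
open import Data.List.Relation.Unary.All using (All)
open import Data.List.Relation.Unary.All using (all?)
open import Data.Maybe using (Maybe; just; nothing)
open import Data.Product using (_×_; _,_; proj₁; proj₂)
open import Data.Integer as ℤ using (ℤ; +_; ∣_∣)
import Data.Integer.Properties as ℤP
open import Relation.Nullary using (Dec)
open import Relation.Nullary.Decidable using (_×-dec_)
open import Relation.Binary.PropositionalEquality using (_≡_)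

-- A k⃗-Dyck path is a word in the letters S^{k_1},…,S^{k_ℓ}
-- (occurring once each, in this order) and W.  Since the S-letters must
-- occur in the fixed order, the j-th occurrence of S in the word denotes
-- S^{k_j}; so a word is stored as a list over {S, W}, together with the
-- vector k⃗ (a path is a pair (k⃗ , word), see DPath below).

data Letter : Set where
  S W : Letter

countS countW : List Letter → ℕ
countS [] = 0
countS (S ∷ w) = suc (countS w)
countS (W ∷ w) = countS w
countW [] = 0
countW (S ∷ w) = countW w
countW (W ∷ w) = suc (countW w)

private
  hd : List ℕ → ℕ
  hd [] = 0
  hd (k ∷ _) = k
  tl : List ℕ → List ℕ
  tl [] = []
  tl (_ ∷ ks) = ks

ranksFrom : ℤ → List ℕ → List Letter → List ℤ
ranksFrom r ks [] = []
ranksFrom r ks (S ∷ w) = r ∷ ranksFrom (r ℤ.+ + hd ks) (tl ks) w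
ranksFrom r ks (W ∷ w) = r ∷ ranksFrom (r ℤ.- ℤ.1ℤ) ks w

ranks : List ℕ → List Letter → List ℤ
ranks ks w = ranksFrom (+ 0) ks w

IsDyck : List ℕ → List Letter → Set
IsDyck ks w = (countS w ≡ length ks) × (countW w ≡ sum ks) × All (ℤ._≤_ (+ 0)) (ranks ks w)

isDyck? : (ks : List ℕ) → (w : List Letter) → Dec (IsDyck ks w)
isDyck? ks w = (countS w ≟ length ks) ×-dec ((countW w ≟ sum ks) ×-dec all? (ℤP._≤?_ (+ 0)) (ranks ks w))

allWords : ℕ → List (List Letter)
allWords zero = [ [] ]
allWords (suc n) = concatMap (λ w → (S ∷ w) ∷ (W ∷ w) ∷ []) (allWords n)

Dyck : List ℕ → List (List Letter)
Dyck ks = filter (isDyck? ks) (allWords (sum ks + length ks))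

areaSeq : List ℕ → List Letter → List ℕ
areaSeq ks w = go (ranks ks w) w
  where
  go : List ℤ → List Letter → List ℕ
  go (r ∷ rs) (S ∷ w) = ∣ r ∣ ∷ go rs w
  go (r ∷ rs) (W ∷ w) = go rs w
  go _ _ = []

area : List ℕ → List Letter → ℕ
area ks w = sum (areaSeq ks w)

-- Filling algorithm η_*.  A tableau is a list of ℓ columns, each column
-- the list of its entries from top to bottom; column j has k_j + 1 cells.

activeEntry : ℕ → List ℕ → Maybe ℕ
activeEntry cap [] = nothing
activeEntry cap col@(_ ∷ _) = if length col <ᵇ cap then last col else nothing

maxMaybe : Maybe ℕ → Maybe ℕ → Maybe ℕ
maxMaybe nothing m = m
maxMaybe (just a) nothing = just a
maxMaybe (just a) (just b) = just (a ⊔ b)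

largestActive : List ℕ → List (List ℕ) → Maybe ℕ
largestActive (cap ∷ caps) (col ∷ cols) = maxMaybe (activeEntry cap col) (largestActive caps cols)
largestActive _ _ = nothing

placeS : ℕ → List (List ℕ) → List (List ℕ)
placeS i [] = []
placeS i ([] ∷ cols) = [ i ] ∷ cols
placeS i (col@(_ ∷ _) ∷ cols) = col ∷ placeS i cols

placeBelow : ℕ → ℕ → List (List ℕ) → List (List ℕ)
placeBelow m i = map (λ col → isBottom col)
  where
  isBottom : List ℕ → List ℕ
  isBottom col with last col
  ... | just b  = if b ≡ᵇ m then col ++ [ i ] else col
  ... | nothing = col

placeW : List ℕ → ℕ → List (List ℕ) → List (List ℕ)
placeW caps i cols with largestActive caps cols
... | just m  = placeBelow m i cols
... | nothing = cols

fill : List ℕ → List Letter → List (List ℕ)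
fill ks w = go 1 w (replicate (length ks) [])
  where
  caps : List ℕ
  caps = map suc ks
  go : ℕ → List Letter → List (List ℕ) → List (List ℕ)
  go i [] cols = cols
  go i (S ∷ w) cols = go (suc i) w (placeS i cols)
  go i (W ∷ w) cols = go (suc i) w (placeW caps i cols)

-- Ranking algorithm.  Column i receives ranks α, α+1, …, α+k_i from top
-- to bottom; we compute the list of the α's (the ranks of the first row).

nth : List ℕ → ℕ → ℕ
nth [] _ = 0
nth (x ∷ xs) zero = x
nth (x ∷ xs) (suc n) = nth xs n

-- (column index, row index), both from 0, of entry A in the tableau
locate : ℕ → List (List ℕ) → Maybe (ℕ × ℕ)
locate A F = locCols 0 F
  where
  findRow : ℕ → List ℕ → Maybe ℕ
  findRow r [] = nothing
  findRow r (x ∷ xs) = if x ≡ᵇ A then just r else findRow (suc r) xs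
  locCols : ℕ → List (List ℕ) → Maybe (ℕ × ℕ)
  locCols c [] = nothing
  locCols c (col ∷ cols) with findRow 0 col
  ... | just r  = just (c , r)
  ... | nothing = locCols (suc c) cols

topRanks : List (List ℕ) → List ℕ
topRanks F = go F []
  where
  baseOf : List ℕ → List ℕ → ℕ
  baseOf (suc A ∷ _) αs with locate A F
  ... | just (c , r) = nth αs c + r      -- rank of cell (c, r) is α_c + r
  ... | nothing = 0
  baseOf _ αs = 0
  go : List (List ℕ) → List ℕ → List ℕ
  go [] αs = αs
  go (col ∷ cols) [] = go cols [ 0 ]
  go (col ∷ cols) αs@(_ ∷ _) = go cols (αs ++ [ baseOf col αs ])

depthSeq : List ℕ → List Letter → List ℕ
depthSeq ks w = topRanks (fill ks w)

depth : List ℕ → List Letter → ℕ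
depth ks w = sum (depthSeq ks w)

insertions : ℕ → List ℕ → List (List ℕ)
insertions x [] = [ [ x ] ]
insertions x (y ∷ ys) = (x ∷ y ∷ ys) ∷ map (y ∷_) (insertions x ys)

permutations : List ℕ → List (List ℕ)
permutations [] = [ [] ]
permutations (x ∷ xs) = concatMap (insertions x) (permutations xs)

rearrangements : List ℕ → List (List ℕ)
rearrangements ks = deduplicate (≡-dec _≟_) (permutations ks)

prefixK : ℕ → List ℕ → List (List ℕ)
prefixK a ks = map (a ∷_) (rearrangements ks)

DPath : Set
DPath = List ℕ × List Letter

DyckSet : List (List ℕ) → List DPath
DyckSet 𝒮 = concatMap (λ js → map (js ,_) (Dyck js)) 𝒮

-- A polynomial in ℕ[q,t] is represented by its coefficient function:
-- P i j = coefficient of q^i t^j.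
Poly₂ : Set
Poly₂ = ℕ → ℕ → ℕ

Ctilde : List (List ℕ) → Poly₂
Ctilde 𝒮 i j = length (filter (λ p → (area (proj₁ p) (proj₂ p) ≟ i) ×-dec (depth (proj₁ p) (proj₂ p) ≟ j)) (DyckSet 𝒮))

QTSymmetric : Poly₂ → Set
QTSymmetric P = ∀ i j → P i j ≡ P j i

-- A path factors uniquely as S^k P₀ W P₁ W ⋯ W P_k with (possibly empty) paths Pᵢ,
-- so paths are plane trees in which a node with step S^k has k + 1 ordered slots.
-- The subtree in slot i of a node of rank h starts at rank h + k − i, while in η_*
-- its first label directly follows the entry in row i of the node's column, so
-- its depth rank is the node's depth rank plus i.  Reversing the slots at every
-- node is therefore an involution exchanging the area sequence with the depth
-- labeling sequence (up to order).  It keeps the first step S^a and permutes the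
-- others, so it maps 𝒟_{^a𝒦} onto itself, and C̃ is symmetric.

{-# OPTIONS --safe #-}
module Submission where

open import Defs
open import Data.Bool using (true; false)
open import Data.Bool.Properties using (T-≡; ¬-not)
open import Data.Empty using (⊥; ⊥-elim)
open import Data.Integer as ℤ using (ℤ; +≤+)
open import Data.List as List using (List; []; _∷_; _++_; [_]; length; map; concat; concatMap; filter; replicate; last)
open import Data.List.Properties
  using (++-assoc; ++-identityʳ; length-++; map-++; length-map; concat-++; ≡-dec; ∷-injectiveˡ; ∷-injectiveʳ)
open import Data.List.Membership.Propositional using (_∈_)
open import Data.List.Membership.Propositional.Properties
  using (∈-map⁺; ∈-map⁻; ∈-concat⁺′; ∈-concat⁻′; ∈-filter⁺; ∈-filter⁻; ∈-∃++; ∈-deduplicate⁺; ∈-deduplicate⁻)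
open import Data.List.Membership.Propositional.Properties.WithK using (unique∧set⇒bag)
open import Data.List.Relation.Binary.BagAndSetEquality using (∼bag⇒↭)
open import Data.List.Relation.Binary.Permutation.Propositional
  using (_↭_; ↭-refl; ↭-sym; ↭-trans; prep; swap; ↭⇒↭ₛ; module PermutationReasoning)
import Data.List.Relation.Binary.Permutation.Propositional.Properties as ↭
open import Data.List.Relation.Binary.Permutation.Setoid.Properties using (Unique-resp-↭)
open import Data.List.Relation.Binary.Pointwise as Pointwise using (Pointwise; []; _∷_; Pointwise-length)
open import Data.List.Relation.Unary.All as All using (All; []; _∷_)
import Data.List.Relation.Unary.All.Properties as Allₚ
open import Data.List.Relation.Unary.AllPairs using ([]; _∷_)
open import Data.List.Relation.Unary.Any using (here; there)
open import Data.List.Relation.Unary.Unique.Propositional using (Unique)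
import Data.List.Relation.Unary.Unique.Propositional.Properties as Unique
open import Data.Maybe using (Maybe; just; nothing)
open import Data.Nat using (ℕ; zero; suc; _+_; _≤_; _<_; z≤n; s≤s; z<s; s<s; _≟_; _≡ᵇ_; _<ᵇ_)
open import Data.Nat.ListAction using (sum)
open import Data.Nat.ListAction.Properties using (sum-↭)
open import Data.Nat.Properties
  using (+-suc; +-comm; +-assoc; +-identityʳ; suc-injective; ≤-refl; ≤-reflexive; ≤-trans; <-≤-trans; <-irrefl;
         <⇒≤; <⇒≢; n≤1+n; m≤m+n; m≤n+m; m<m+n; m+1+n≰m; m≤n⇒m⊔n≡n; ≡ᵇ⇒≡; ≡⇒≡ᵇ; <ᵇ⇒<; <⇒<ᵇ)
open import Data.Product using (Σ; _×_; _,_; proj₁; proj₂)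
open import Data.Unit using (⊤; tt)
open import Function.Bundles using (_⇔_; mk⇔; Equivalence)
open import Level using (0ℓ)
open import Relation.Binary.PropositionalEquality
  using (_≡_; _≢_; refl; sym; trans; cong; cong₂; subst; setoid; module ≡-Reasoning)
open import Relation.Nullary using (Dec; yes; no; ¬_; _because_)
open import Relation.Nullary.Decidable using (_×-dec_)
open import Relation.Unary using (Pred; Decidable)

open import Data.List.Relation.Unary.Unique.DecPropositional.Properties (≡-dec _≟_) using (deduplicate-!)

≡ᵇ-refl : ∀ n → (n ≡ᵇ n) ≡ true
≡ᵇ-refl n = Equivalence.to T-≡ (≡⇒≡ᵇ n n refl)

≢⇒≡ᵇ-false : ∀ {m n} → m ≢ n → (m ≡ᵇ n) ≡ false
≢⇒≡ᵇ-false {m} {n} m≢n = ¬-not (λ e → m≢n (≡ᵇ⇒≡ m n (Equivalence.from T-≡ e)))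

<⇒<ᵇ-true : ∀ {m n} → m < n → (m <ᵇ n) ≡ true
<⇒<ᵇ-true m<n = Equivalence.to T-≡ (<⇒<ᵇ m<n)

<ᵇ-irrefl : ∀ n → (n <ᵇ n) ≡ false
<ᵇ-irrefl n = ¬-not (λ e → <-irrefl refl (<ᵇ⇒< n n (Equivalence.from T-≡ e)))

last-∷ʳ : ∀ (xs : List ℕ) y → last (xs ++ [ y ]) ≡ just y
last-∷ʳ [] y = refl
last-∷ʳ (x ∷ []) y = refl
last-∷ʳ (x ∷ x′ ∷ xs) y = last-∷ʳ (x′ ∷ xs) y

All-last : ∀ {P : ℕ → Set} {xs c} → All P xs → last xs ≡ just c → P c
All-last (p ∷ []) refl = p
All-last (_ ∷ ps@(_ ∷ _)) e = All-last ps e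

Unique-++-∷ : ∀ (xs : List ℕ) A ys → Unique (xs ++ A ∷ ys) → All (_≢ A) xs
Unique-++-∷ [] A ys u = []
Unique-++-∷ (x ∷ xs) A ys (x∉ ∷ u) = head-≢ xs x∉ ∷ Unique-++-∷ xs A ys u
  where
  head-≢ : ∀ {x} zs → All (x ≢_) (zs ++ A ∷ ys) → x ≢ A
  head-≢ [] (x≢A ∷ _) = x≢A
  head-≢ (_ ∷ zs) (_ ∷ ne) = head-≢ zs ne

Unique-concatMap : ∀ {A B : Set} (f : A → List B) {xs} → Unique xs → (∀ x → Unique (f x)) →
  (∀ {x y z} → z ∈ f x → z ∈ f y → x ≡ y) → Unique (concatMap f xs)
Unique-concatMap f [] _ _ = []
Unique-concatMap f {x ∷ xs} (x∉ ∷ u) uf disj =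
  Unique.++⁺ (uf x) (Unique-concatMap f u uf disj) separate
  where
  ≢-∈ : ∀ {y ys} → All (x ≢_) ys → y ∈ ys → x ≢ y
  ≢-∈ (x≢y ∷ _) (here refl) = x≢y
  ≢-∈ (_ ∷ ne) (there m) = ≢-∈ ne m
  separate : ∀ {v} → ¬ (v ∈ f x × v ∈ concatMap f xs)
  separate (m₁ , m₂) with ∈-concat⁻′ (map f xs) m₂
  ... | _ , m₃ , m₄ with ∈-map⁻ f m₄
  ... | y , m₅ , refl = ≢-∈ x∉ m₅ (disj m₁ m₃)

module _ {A : Set} where

  length-filter-map : {P : Pred A 0ℓ} (P? : Decidable P) (f : A → A) (xs : List A) →
    length (filter P? (map f xs)) ≡ length (filter (λ x → P? (f x)) xs)
  length-filter-map P? f [] = refl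
  length-filter-map P? f (x ∷ xs) with P? (f x)
  ... | true because _ = cong suc (length-filter-map P? f xs)
  ... | false because _ = length-filter-map P? f xs

  length-filter-cong : {P Q : Pred A 0ℓ} (P? : Decidable P) (Q? : Decidable Q) (xs : List A) →
    (∀ {x} → x ∈ xs → P x ⇔ Q x) → length (filter P? xs) ≡ length (filter Q? xs)
  length-filter-cong P? Q? [] _ = refl
  length-filter-cong P? Q? (x ∷ xs) P⇔Q with P? x | Q? x
  ... | yes _ | yes _ = cong suc (length-filter-cong P? Q? xs (λ m → P⇔Q (there m)))
  ... | yes p | no ¬q = ⊥-elim (¬q (Equivalence.to (P⇔Q (here refl)) p))
  ... | no ¬p | yes q = ⊥-elim (¬p (Equivalence.from (P⇔Q (here refl)) q))
  ... | no _  | no _  = length-filter-cong P? Q? xs (λ m → P⇔Q (there m))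

  -- f permutes xs, which is duplicate-free and closed under the injective f.
  length-filter-involution : (f : A → A) → (∀ x → f (f x) ≡ x) → ∀ {xs} → Unique xs → (∀ {x} → x ∈ xs → f x ∈ xs) →
    {P Q : Pred A 0ℓ} (P? : Decidable P) (Q? : Decidable Q) → (∀ {x} → x ∈ xs → P (f x) ⇔ Q x) →
    length (filter P? xs) ≡ length (filter Q? xs)
  length-filter-involution f f∘f {xs} u closed P? Q? P∘f⇔Q =
    trans (↭.↭-length (↭.filter-↭ P? xs↭fxs))
          (trans (length-filter-map P? f xs) (length-filter-cong (λ x → P? (f x)) Q? xs P∘f⇔Q))
    where
    f-injective : ∀ {x y} → f x ≡ f y → x ≡ y
    f-injective {x} {y} e = trans (sym (f∘f x)) (trans (cong f e) (f∘f y))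
    ∈-map-f : ∀ {x} → x ∈ map f xs → x ∈ xs
    ∈-map-f m with ∈-map⁻ f m
    ... | _ , m′ , refl = closed m′
    xs↭fxs : xs ↭ map f xs
    xs↭fxs = ∼bag⇒↭ (unique∧set⇒bag u (Unique.map⁺ f-injective u)
      (λ {x} → mk⇔ (λ m → subst (_∈ map f xs) (f∘f x) (∈-map⁺ f (closed m))) ∈-map-f))

blanks : ℕ → List (List ℕ)
blanks n = replicate n []

-- The recursive helpers of fill, areaSeq, topRanks and locate are local to
-- where-blocks of Defs.  Each is named here as the solution of a metavariable,
-- fixed by the unfolding lemma (proved by refl) next to it; the two lemmas about
-- locate serve only this purpose.
mutual
  fillFrom : List ℕ → ℕ → List Letter → List (List ℕ) → List (List ℕ)
  fillFrom = _

  fill≡fillFrom : ∀ ks w → fill ks w ≡ fillFrom ks 1 w (blanks (length ks))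
  fill≡fillFrom ks w with 1 | blanks (length ks)
  ... | i | cols = refl

mutual
  areaSeqFrom : List ℕ → List ℤ → List Letter → List ℕ
  areaSeqFrom = _

  areaSeq≡areaSeqFrom : ∀ ks w → areaSeq ks w ≡ areaSeqFrom ks (ranks ks w) w
  areaSeq≡areaSeqFrom ks w with ranks ks w
  ... | rs = refl

mutual
  topRanksFrom : List (List ℕ) → List (List ℕ) → List ℕ → List ℕ
  topRanksFrom = _

  topRanks≡topRanksFrom : ∀ col cols → topRanks (col ∷ cols) ≡ topRanksFrom (col ∷ cols) cols [ 0 ]
  topRanks≡topRanksFrom col cols with col ∷ cols | [ 0 ]
  ... | F | αs = refl

mutual
  locateFrom : ℕ → List (List ℕ) → ℕ → List (List ℕ) → Maybe (ℕ × ℕ)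
  locateFrom = _

  locate-[]∷ : ∀ A cols → locate A ([] ∷ cols) ≡ locateFrom A ([] ∷ cols) 1 cols
  locate-[]∷ A cols with List.[] List.∷ cols
  ... | F with 1
  ... | c = refl

mutual
  locateInColumn : ℕ → List (List ℕ) → ℕ → ℕ → List ℕ → List (List ℕ) → Maybe (ℕ × ℕ)
  locateInColumn = _

  locate-[]∷∷ : ∀ A col cols → locate A ([] ∷ col ∷ cols) ≡ locateInColumn A ([] ∷ col ∷ cols) 1 0 col cols
  locate-[]∷∷ A col cols with List.[] List.∷ col List.∷ cols
  ... | F with 1
  ... | c with 0
  ... | r = refl

-- Plane trees and their mirror images

-- A node with k + 1 slots, each empty or holding a subtree, has the up-step S^k.
mutual
  data Tree : Set where
    node : Slots → Tree

  data Slots : Set where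
    [_]ˢ : Slot → Slots
    _∷ˢ_ : Slot → Slots → Slots

  data Slot : Set where
    empty : Slot
    tree  : Tree → Slot

infixr 5 _∷ˢ_ _∷ʳˢ_

degree : Slots → ℕ
degree [ _ ]ˢ = 0
degree (_ ∷ˢ ss) = suc (degree ss)

_∷ʳˢ_ : Slots → Slot → Slots
[ o ]ˢ ∷ʳˢ p = o ∷ˢ [ p ]ˢ
(o ∷ˢ ss) ∷ʳˢ p = o ∷ˢ (ss ∷ʳˢ p)

degree-∷ʳˢ : ∀ ss o → degree (ss ∷ʳˢ o) ≡ suc (degree ss)
degree-∷ʳˢ [ _ ]ˢ o = refl
degree-∷ʳˢ (_ ∷ˢ ss) o = cong suc (degree-∷ʳˢ ss o)

mutual
  wordᵗ : Tree → List Letter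
  wordᵗ (node ss) = S ∷ wordˢ ss

  wordˢ : Slots → List Letter
  wordˢ [ o ]ˢ = wordᵒ o
  wordˢ (o ∷ˢ ss) = wordᵒ o ++ W ∷ wordˢ ss

  wordᵒ : Slot → List Letter
  wordᵒ empty = []
  wordᵒ (tree t) = wordᵗ t

mutual
  stepsᵗ : Tree → List ℕ
  stepsᵗ (node ss) = degree ss ∷ stepsˢ ss

  stepsˢ : Slots → List ℕ
  stepsˢ [ o ]ˢ = stepsᵒ o
  stepsˢ (o ∷ˢ ss) = stepsᵒ o ++ stepsˢ ss

  stepsᵒ : Slot → List ℕ
  stepsᵒ empty = []
  stepsᵒ (tree t) = stepsᵗ t

mutual
  mirrorᵗ : Tree → Tree
  mirrorᵗ (node ss) = node (mirrorˢ ss)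

  mirrorˢ : Slots → Slots
  mirrorˢ [ o ]ˢ = [ mirrorᵒ o ]ˢ
  mirrorˢ (o ∷ˢ ss) = mirrorˢ ss ∷ʳˢ mirrorᵒ o

  mirrorᵒ : Slot → Slot
  mirrorᵒ empty = empty
  mirrorᵒ (tree t) = tree (mirrorᵗ t)

mirrorˢ-∷ʳˢ : ∀ ss o → mirrorˢ (ss ∷ʳˢ o) ≡ mirrorᵒ o ∷ˢ mirrorˢ ss
mirrorˢ-∷ʳˢ [ _ ]ˢ o = refl
mirrorˢ-∷ʳˢ (p ∷ˢ ss) o rewrite mirrorˢ-∷ʳˢ ss o = refl

mutual
  mirrorᵗ-involutive : ∀ t → mirrorᵗ (mirrorᵗ t) ≡ t
  mirrorᵗ-involutive (node ss) = cong node (mirrorˢ-involutive ss)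

  mirrorˢ-involutive : ∀ ss → mirrorˢ (mirrorˢ ss) ≡ ss
  mirrorˢ-involutive [ o ]ˢ = cong [_]ˢ (mirrorᵒ-involutive o)
  mirrorˢ-involutive (o ∷ˢ ss) rewrite mirrorˢ-∷ʳˢ (mirrorˢ ss) (mirrorᵒ o) =
    cong₂ _∷ˢ_ (mirrorᵒ-involutive o) (mirrorˢ-involutive ss)

  mirrorᵒ-involutive : ∀ o → mirrorᵒ (mirrorᵒ o) ≡ o
  mirrorᵒ-involutive empty = refl
  mirrorᵒ-involutive (tree t) = cong tree (mirrorᵗ-involutive t)

degree-mirror : ∀ ss → degree (mirrorˢ ss) ≡ degree ss
degree-mirror [ _ ]ˢ = refl
degree-mirror (o ∷ˢ ss) = trans (degree-∷ʳˢ (mirrorˢ ss) (mirrorᵒ o)) (cong suc (degree-mirror ss))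

stepsˢ-∷ʳˢ : ∀ ss o → stepsˢ (ss ∷ʳˢ o) ≡ stepsˢ ss ++ stepsᵒ o
stepsˢ-∷ʳˢ [ _ ]ˢ o = refl
stepsˢ-∷ʳˢ (p ∷ˢ ss) o rewrite stepsˢ-∷ʳˢ ss o = sym (++-assoc (stepsᵒ p) (stepsˢ ss) (stepsᵒ o))

mutual
  steps-mirrorᵗ : ∀ t → stepsᵗ (mirrorᵗ t) ↭ stepsᵗ t
  steps-mirrorᵗ (node ss) rewrite degree-mirror ss = prep (degree ss) (steps-mirrorˢ ss)

  steps-mirrorˢ : ∀ ss → stepsˢ (mirrorˢ ss) ↭ stepsˢ ss
  steps-mirrorˢ [ o ]ˢ = steps-mirrorᵒ o
  steps-mirrorˢ (o ∷ˢ ss) rewrite stepsˢ-∷ʳˢ (mirrorˢ ss) (mirrorᵒ o) =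
    ↭-trans (↭.++⁺ (steps-mirrorˢ ss) (steps-mirrorᵒ o)) (↭.++-comm (stepsˢ ss) (stepsᵒ o))

  steps-mirrorᵒ : ∀ o → stepsᵒ (mirrorᵒ o) ↭ stepsᵒ o
  steps-mirrorᵒ empty = ↭-refl
  steps-mirrorᵒ (tree t) = steps-mirrorᵗ t

-- In the word, slot i of a node of degree k at rank h starts at rank h + k − i;
-- in η_* its first label directly follows the entry in row i of the node's column.
mutual
  areaSeqᵗ : ℕ → Tree → List ℕ
  areaSeqᵗ h (node ss) = h ∷ areaSeqˢ h ss

  areaSeqˢ : ℕ → Slots → List ℕ
  areaSeqˢ h [ o ]ˢ = areaSeqᵒ h o
  areaSeqˢ h (o ∷ˢ ss) = areaSeqᵒ (h + suc (degree ss)) o ++ areaSeqˢ h ss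

  areaSeqᵒ : ℕ → Slot → List ℕ
  areaSeqᵒ h empty = []
  areaSeqᵒ h (tree t) = areaSeqᵗ h t

mutual
  depthSeqᵗ : ℕ → Tree → List ℕ
  depthSeqᵗ r (node ss) = r ∷ depthSeqˢ r ss

  depthSeqˢ : ℕ → Slots → List ℕ
  depthSeqˢ r [ o ]ˢ = depthSeqᵒ r o
  depthSeqˢ r (o ∷ˢ ss) = depthSeqᵒ r o ++ depthSeqˢ (suc r) ss

  depthSeqᵒ : ℕ → Slot → List ℕ
  depthSeqᵒ r empty = []
  depthSeqᵒ r (tree t) = depthSeqᵗ r t

areaSeqˢ-∷ʳˢ : ∀ h ss o → areaSeqˢ h (ss ∷ʳˢ o) ≡ areaSeqˢ (suc h) ss ++ areaSeqᵒ h o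
areaSeqˢ-∷ʳˢ h [ p ]ˢ o rewrite +-suc h 0 | +-identityʳ h = refl
areaSeqˢ-∷ʳˢ h (p ∷ˢ ss) o
  rewrite degree-∷ʳˢ ss o | areaSeqˢ-∷ʳˢ h ss o | +-suc h (suc (degree ss)) =
  sym (++-assoc (areaSeqᵒ (suc (h + suc (degree ss))) p) (areaSeqˢ (suc h) ss) (areaSeqᵒ h o))

mutual
  areaSeq-mirrorᵗ : ∀ h t → areaSeqᵗ h (mirrorᵗ t) ↭ depthSeqᵗ h t
  areaSeq-mirrorᵗ h (node ss) = prep h (areaSeq-mirrorˢ h ss)

  areaSeq-mirrorˢ : ∀ h ss → areaSeqˢ h (mirrorˢ ss) ↭ depthSeqˢ h ss
  areaSeq-mirrorˢ h [ o ]ˢ = areaSeq-mirrorᵒ h o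
  areaSeq-mirrorˢ h (o ∷ˢ ss) rewrite areaSeqˢ-∷ʳˢ h (mirrorˢ ss) (mirrorᵒ o) =
    ↭-trans (↭.++⁺ (areaSeq-mirrorˢ (suc h) ss) (areaSeq-mirrorᵒ h o))
            (↭.++-comm (depthSeqˢ (suc h) ss) (depthSeqᵒ h o))

  areaSeq-mirrorᵒ : ∀ h o → areaSeqᵒ h (mirrorᵒ o) ↭ depthSeqᵒ h o
  areaSeq-mirrorᵒ h empty = ↭-refl
  areaSeq-mirrorᵒ h (tree t) = areaSeq-mirrorᵗ h t

-- Dyck paths are the words of trees

-- Ranks are natural numbers, so a walk never goes below the axis.
data Walk : ℕ → List ℕ → List Letter → ℕ → Set where
  []   : ∀ {h} → Walk h [] [] h
  up   : ∀ {h k ks w h′} → Walk (h + k) ks w h′ → Walk h (k ∷ ks) (S ∷ w) h′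
  down : ∀ {h ks w h′} → Walk h ks w h′ → Walk (suc h) ks (W ∷ w) h′

_++ʷ_ : ∀ {h ks w h₁ ks′ w′ h₂} → Walk h ks w h₁ → Walk h₁ ks′ w′ h₂ → Walk h (ks ++ ks′) (w ++ w′) h₂
[] ++ʷ q = q
up p ++ʷ q = up (p ++ʷ q)
down p ++ʷ q = down (p ++ʷ q)

Walk-[] : ∀ {h ks h′} → Walk h ks [] h′ → h ≡ h′
Walk-[] [] = refl

nonneg⇒Walk : ∀ h ks w h′ → countS w ≡ length ks → All (ℤ._≤_ (ℤ.+ 0)) (ranksFrom (ℤ.+ h) ks w) →
              h + sum ks ≡ countW w + h′ → Walk h ks w h′
nonneg⇒Walk h [] [] h′ _ _ e rewrite +-identityʳ h | e = []
nonneg⇒Walk h (_ ∷ _) [] h′ () _ _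
nonneg⇒Walk h [] (S ∷ w) h′ () _ _
nonneg⇒Walk h (k ∷ ks) (S ∷ w) h′ c (_ ∷ r) e =
  up (nonneg⇒Walk (h + k) ks w h′ (suc-injective c) r (trans (+-assoc h k (sum ks)) e))
nonneg⇒Walk (suc h) ks (W ∷ w) h′ c (_ ∷ r) e = down (nonneg⇒Walk h ks w h′ c r (suc-injective e))
nonneg⇒Walk zero [] (W ∷ []) h′ _ _ ()
nonneg⇒Walk zero (_ ∷ _) (W ∷ []) h′ () _ _
nonneg⇒Walk zero ks (W ∷ S ∷ w) h′ _ (_ ∷ () ∷ _) _
nonneg⇒Walk zero ks (W ∷ W ∷ w) h′ _ (_ ∷ () ∷ _) _

IsDyck⇒Walk : ∀ {ks w} → IsDyck ks w → Walk 0 ks w 0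
IsDyck⇒Walk {ks} {w} (cS , cW , r) = nonneg⇒Walk 0 ks w 0 cS r (trans (sym cW) (sym (+-identityʳ (countW w))))

Walk-countS : ∀ {h ks w h′} → Walk h ks w h′ → countS w ≡ length ks
Walk-countS [] = refl
Walk-countS (up p) = cong suc (Walk-countS p)
Walk-countS (down p) = Walk-countS p

Walk-countW : ∀ {h ks w h′} → Walk h ks w h′ → h + sum ks ≡ countW w + h′
Walk-countW {h} [] = +-identityʳ h
Walk-countW {h} (up {k = k} {ks = ks} p) = trans (sym (+-assoc h k (sum ks))) (Walk-countW p)
Walk-countW (down p) = cong suc (Walk-countW p)

Walk⇒nonneg : ∀ {h ks w h′} → Walk h ks w h′ → All (ℤ._≤_ (ℤ.+ 0)) (ranksFrom (ℤ.+ h) ks w)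
Walk⇒nonneg [] = []
Walk⇒nonneg (up p) = +≤+ z≤n ∷ Walk⇒nonneg p
Walk⇒nonneg (down p) = +≤+ z≤n ∷ Walk⇒nonneg p

Walk⇒IsDyck : ∀ {ks w} → Walk 0 ks w 0 → IsDyck ks w
Walk⇒IsDyck {ks} {w} p = Walk-countS p , trans (sym (+-identityʳ (countW w))) (sym (Walk-countW p)) , Walk⇒nonneg p

mutual
  walkᵗ : ∀ h t → Walk h (stepsᵗ t) (wordᵗ t) h
  walkᵗ h (node ss) = up (walkˢ h ss)

  walkˢ : ∀ h ss → Walk (h + degree ss) (stepsˢ ss) (wordˢ ss) h
  walkˢ h [ o ]ˢ rewrite +-identityʳ h = walkᵒ h o
  walkˢ h (o ∷ˢ ss) rewrite +-suc h (degree ss) = walkᵒ (suc (h + degree ss)) o ++ʷ down (walkˢ h ss)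

  walkᵒ : ∀ h o → Walk h (stepsᵒ o) (wordᵒ o) h
  walkᵒ h empty = []
  walkᵒ h (tree t) = walkᵗ h t

IsDyck-wordᵒ : ∀ o → IsDyck (stepsᵒ o) (wordᵒ o)
IsDyck-wordᵒ o = Walk⇒IsDyck (walkᵒ 0 o)

-- The letter following a complete slot: none, or the W closing it.
SlotEnd : List Letter → Set
SlotEnd [] = ⊤
SlotEnd (S ∷ _) = ⊥
SlotEnd (W ∷ _) = ⊤

record Parseᵒ (h : ℕ) (ks : List ℕ) (w : List Letter) (h′ : ℕ) : Set where
  constructor parsedᵒ
  field
    slot      : Slot
    rest      : List Letter
    restSteps : List ℕ
    word≡     : w ≡ wordᵒ slot ++ rest
    steps≡    : ks ≡ stepsᵒ slot ++ restSteps
    restWalk  : Walk h restSteps rest h′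
    atEnd     : SlotEnd rest

record Parseˢ (h k : ℕ) (ks : List ℕ) (w : List Letter) (h′ : ℕ) : Set where
  constructor parsedˢ
  field
    slots     : Slots
    degree≡   : degree slots ≡ k
    rest      : List Letter
    restSteps : List ℕ
    word≡     : w ≡ wordˢ slots ++ rest
    steps≡    : ks ≡ stepsˢ slots ++ restSteps
    restWalk  : Walk h restSteps rest h′
    atEnd     : SlotEnd rest

length-++-W∷ : ∀ (u : List Letter) v n → length (u ++ W ∷ v) ≤ n → length v ≤ n
length-++-W∷ u v n l = ≤-trans (≤-trans (n≤1+n (length v)) (m≤n+m (suc (length v)) (length u)))
                               (subst (_≤ n) (length-++ u) l)

-- n bounds the length of the word, which makes the recursion structural.
mutual
  parseᵒ : ∀ n {h ks w h′} → length w ≤ n → h′ ≤ h → Walk h ks w h′ → Parseᵒ h ks w h′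
  parseᵒ n _ _ [] = parsedᵒ empty [] [] refl refl [] tt
  parseᵒ n _ _ (down p) = parsedᵒ empty _ _ refl refl (down p) tt
  parseᵒ (suc n) {h} {k ∷ ks} {S ∷ w} (s≤s l) h′≤h (up p) with parseˢ n k h l h′≤h p
  ... | parsedˢ ss ek rest ks₂ ew eks wk st =
    parsedᵒ (tree (node ss)) rest ks₂ (cong (S ∷_) ew) (cong₂ _∷_ (sym ek) eks) wk st

  parseˢ : ∀ n k h {ks w h′} → length w ≤ n → h′ ≤ h → Walk (h + k) ks w h′ → Parseˢ h k ks w h′
  parseˢ n zero h {ks} {w} {h′} l h′≤h p with parseᵒ n l (≤-trans h′≤h (m≤m+n h 0)) p
  ... | parsedᵒ o rest ks₂ ew eks wk st =
    parsedˢ [ o ]ˢ refl rest ks₂ ew eks (subst (λ x → Walk x ks₂ rest h′) (+-identityʳ h) wk) st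
  parseˢ n (suc k) h {ks} {w} {h′} l h′≤h p with parseᵒ n l (≤-trans h′≤h (m≤m+n h (suc k))) p
  ... | parsedᵒ o [] ks₂ ew eks wk st = ⊥-elim (m+1+n≰m h (subst (_≤ h) (sym (Walk-[] wk)) h′≤h))
  ... | parsedᵒ o (W ∷ r) ks₂ ew eks wk st with subst (λ x → Walk x ks₂ (W ∷ r) h′) (+-suc h k) wk
  ... | down wk′ with parseˢ n k h (length-++-W∷ (wordᵒ o) r n (subst (λ x → length x ≤ n) ew l)) h′≤h wk′
  ... | parsedˢ ss ek rest ks₃ ew′ eks′ wk″ st′ =
    parsedˢ (o ∷ˢ ss) (cong suc ek) rest ks₃
      (trans ew (trans (cong (λ x → wordᵒ o ++ W ∷ x) ew′) (sym (++-assoc (wordᵒ o) (W ∷ wordˢ ss) rest))))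
      (trans eks (trans (cong (stepsᵒ o ++_) eks′) (sym (++-assoc (stepsᵒ o) (stepsˢ ss) ks₃))))
      wk″ st′

parse : ∀ {ks w} → IsDyck ks w → Σ Slot (λ o → stepsᵒ o ≡ ks × wordᵒ o ≡ w)
parse {ks} {w} d with parseᵒ (length w) ≤-refl z≤n (IsDyck⇒Walk d)
... | parsedᵒ o [] [] ew eks [] _ =
  o , sym (trans eks (++-identityʳ (stepsᵒ o))) , sym (trans ew (++-identityʳ (wordᵒ o)))

mutual
  wordᵒ-prefix-unique : ∀ o o′ {r r′ ks ks′} → SlotEnd r → SlotEnd r′ →
    wordᵒ o ++ r ≡ wordᵒ o′ ++ r′ → stepsᵒ o ++ ks ≡ stepsᵒ o′ ++ ks′ → o ≡ o′ × r ≡ r′ × ks ≡ ks′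
  wordᵒ-prefix-unique empty empty _ _ ew eks = refl , ew , eks
  wordᵒ-prefix-unique empty (tree (node _)) {S ∷ _} () _ _ _
  wordᵒ-prefix-unique empty (tree (node _)) {[]} _ _ () _
  wordᵒ-prefix-unique empty (tree (node _)) {W ∷ _} _ _ () _
  wordᵒ-prefix-unique (tree (node _)) empty {r′ = S ∷ _} _ () _ _
  wordᵒ-prefix-unique (tree (node _)) empty {r′ = []} _ _ () _
  wordᵒ-prefix-unique (tree (node _)) empty {r′ = W ∷ _} _ _ () _
  wordᵒ-prefix-unique (tree t) (tree t′) e e′ ew eks with wordᵗ-prefix-unique t t′ e e′ ew eks
  ... | refl , er , eks′ = refl , er , eks′

  wordᵗ-prefix-unique : ∀ t t′ {r r′ ks ks′} → SlotEnd r → SlotEnd r′ →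
    wordᵗ t ++ r ≡ wordᵗ t′ ++ r′ → stepsᵗ t ++ ks ≡ stepsᵗ t′ ++ ks′ → t ≡ t′ × r ≡ r′ × ks ≡ ks′
  wordᵗ-prefix-unique (node ss) (node ss′) e e′ ew eks
    with wordˢ-prefix-unique ss ss′ (∷-injectiveˡ eks) e e′ (∷-injectiveʳ ew) (∷-injectiveʳ eks)
  ... | refl , er , eks′ = refl , er , eks′

  wordˢ-prefix-unique : ∀ ss ss′ {r r′ ks ks′} → degree ss ≡ degree ss′ → SlotEnd r → SlotEnd r′ →
    wordˢ ss ++ r ≡ wordˢ ss′ ++ r′ → stepsˢ ss ++ ks ≡ stepsˢ ss′ ++ ks′ → ss ≡ ss′ × r ≡ r′ × ks ≡ ks′
  wordˢ-prefix-unique [ o ]ˢ [ o′ ]ˢ _ e e′ ew eks with wordᵒ-prefix-unique o o′ e e′ ew eks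
  ... | refl , er , eks′ = refl , er , eks′
  wordˢ-prefix-unique [ _ ]ˢ (_ ∷ˢ _) () _ _ _ _
  wordˢ-prefix-unique (_ ∷ˢ _) [ _ ]ˢ () _ _ _ _
  wordˢ-prefix-unique (o ∷ˢ ss) (o′ ∷ˢ ss′) {r} {r′} {ks} {ks′} ed e e′ ew eks
    with wordᵒ-prefix-unique o o′ {W ∷ wordˢ ss ++ r} {W ∷ wordˢ ss′ ++ r′} {stepsˢ ss ++ ks} {stepsˢ ss′ ++ ks′} tt tt
           (trans (sym (++-assoc (wordᵒ o) (W ∷ wordˢ ss) r)) (trans ew (++-assoc (wordᵒ o′) (W ∷ wordˢ ss′) r′)))
           (trans (sym (++-assoc (stepsᵒ o) (stepsˢ ss) ks)) (trans eks (++-assoc (stepsᵒ o′) (stepsˢ ss′) ks′)))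
  ... | refl , ew′ , eks′ with wordˢ-prefix-unique ss ss′ (suc-injective ed) e e′ (∷-injectiveʳ ew′) eks′
  ... | refl , er , eks″ = refl , er , eks″

wordᵒ-injective : ∀ o o′ → stepsᵒ o ≡ stepsᵒ o′ → wordᵒ o ≡ wordᵒ o′ → o ≡ o′
wordᵒ-injective o o′ eks ew with wordᵒ-prefix-unique o o′ {[]} {[]} {[]} {[]} tt tt
  (trans (++-identityʳ (wordᵒ o)) (trans ew (sym (++-identityʳ (wordᵒ o′)))))
  (trans (++-identityʳ (stepsᵒ o)) (trans eks (sym (++-identityʳ (stepsᵒ o′)))))
... | e , _ = e

mutual
  areaSeqFrom-wordᵗ : ∀ K h t ks rest →
    areaSeqFrom K (ranksFrom (ℤ.+ h) (stepsᵗ t ++ ks) (wordᵗ t ++ rest)) (wordᵗ t ++ rest)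
      ≡ areaSeqᵗ h t ++ areaSeqFrom K (ranksFrom (ℤ.+ h) ks rest) rest
  areaSeqFrom-wordᵗ K h (node ss) ks rest = cong (h ∷_) (areaSeqFrom-wordˢ K h ss ks rest)

  areaSeqFrom-wordˢ : ∀ K h ss ks rest →
    areaSeqFrom K (ranksFrom (ℤ.+ (h + degree ss)) (stepsˢ ss ++ ks) (wordˢ ss ++ rest)) (wordˢ ss ++ rest)
      ≡ areaSeqˢ h ss ++ areaSeqFrom K (ranksFrom (ℤ.+ h) ks rest) rest
  areaSeqFrom-wordˢ K h [ o ]ˢ ks rest rewrite +-identityʳ h = areaSeqFrom-wordᵒ K h o ks rest
  areaSeqFrom-wordˢ K h (o ∷ˢ ss) ks rest
    rewrite ++-assoc (wordᵒ o) (W ∷ wordˢ ss) rest | ++-assoc (stepsᵒ o) (stepsˢ ss) ks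
          | ++-assoc (areaSeqᵒ (h + suc (degree ss)) o) (areaSeqˢ h ss) (areaSeqFrom K (ranksFrom (ℤ.+ h) ks rest) rest)
          | areaSeqFrom-wordᵒ K (h + suc (degree ss)) o (stepsˢ ss ++ ks) (W ∷ wordˢ ss ++ rest)
          | +-suc h (degree ss)
    = cong (areaSeqᵒ (suc (h + degree ss)) o ++_) (areaSeqFrom-wordˢ K h ss ks rest)

  areaSeqFrom-wordᵒ : ∀ K h o ks rest →
    areaSeqFrom K (ranksFrom (ℤ.+ h) (stepsᵒ o ++ ks) (wordᵒ o ++ rest)) (wordᵒ o ++ rest)
      ≡ areaSeqᵒ h o ++ areaSeqFrom K (ranksFrom (ℤ.+ h) ks rest) rest
  areaSeqFrom-wordᵒ K h empty ks rest = refl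
  areaSeqFrom-wordᵒ K h (tree t) ks rest = areaSeqFrom-wordᵗ K h t ks rest

areaSeq-wordᵒ : ∀ o → areaSeq (stepsᵒ o) (wordᵒ o) ≡ areaSeqᵒ 0 o
areaSeq-wordᵒ o
  with areaSeqFrom-wordᵒ (stepsᵒ o) 0 o [] []
... | e rewrite ++-identityʳ (stepsᵒ o) | ++-identityʳ (wordᵒ o) | ++-identityʳ (areaSeqᵒ 0 o)
  = trans (areaSeq≡areaSeqFrom (stepsᵒ o) (wordᵒ o)) e

-- The tableau η_* of the word of a tree

mutual
  sizeᵗ : Tree → ℕ
  sizeᵗ (node ss) = suc (sizeˢ ss)

  sizeˢ : Slots → ℕ
  sizeˢ [ o ]ˢ = sizeᵒ o
  sizeˢ (o ∷ˢ ss) = sizeᵒ o + suc (sizeˢ ss)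

  sizeᵒ : Slot → ℕ
  sizeᵒ empty = 0
  sizeᵒ (tree t) = sizeᵗ t

-- The labels placed at the W's of a node whose slots are filled from label j on.
columnTail : ℕ → Slots → List ℕ
columnTail j [ o ]ˢ = []
columnTail j (o ∷ˢ ss) = (j + sizeᵒ o) ∷ columnTail (suc (j + sizeᵒ o)) ss

mutual
  columnsᵗ : ℕ → Tree → List (List ℕ)
  columnsᵗ i (node ss) = (i ∷ columnTail (suc i) ss) ∷ columnsˢ (suc i) ss

  columnsˢ : ℕ → Slots → List (List ℕ)
  columnsˢ j [ o ]ˢ = columnsᵒ j o
  columnsˢ j (o ∷ˢ ss) = columnsᵒ j o ++ columnsˢ (suc (j + sizeᵒ o)) ss

  columnsᵒ : ℕ → Slot → List (List ℕ)
  columnsᵒ j empty = []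
  columnsᵒ j (tree t) = columnsᵗ j t

length-columnTail : ∀ j ss → length (columnTail j ss) ≡ degree ss
length-columnTail j [ o ]ˢ = refl
length-columnTail j (o ∷ˢ ss) = cong suc (length-columnTail _ ss)

Full : List ℕ → List (List ℕ) → Set
Full = Pointwise (λ k col → length col ≡ suc k)

mutual
  full-columnsᵗ : ∀ i t → Full (stepsᵗ t) (columnsᵗ i t)
  full-columnsᵗ i (node ss) = cong suc (length-columnTail (suc i) ss) ∷ full-columnsˢ (suc i) ss

  full-columnsˢ : ∀ j ss → Full (stepsˢ ss) (columnsˢ j ss)
  full-columnsˢ j [ o ]ˢ = full-columnsᵒ j o
  full-columnsˢ j (o ∷ˢ ss) = Pointwise.++⁺ (full-columnsᵒ j o) (full-columnsˢ _ ss)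

  full-columnsᵒ : ∀ j o → Full (stepsᵒ o) (columnsᵒ j o)
  full-columnsᵒ j empty = []
  full-columnsᵒ j (tree t) = full-columnsᵗ j t

range : ℕ → ℕ → List ℕ
range i zero = []
range i (suc n) = i ∷ range (suc i) n

range-++ : ∀ i m n → range i (m + n) ≡ range i m ++ range (i + m) n
range-++ i zero n rewrite +-identityʳ i = refl
range-++ i (suc m) n rewrite +-suc i m = cong (i ∷_) (range-++ (suc i) m n)

Between : ℕ → ℕ → ℕ → Set
Between lo hi x = lo ≤ x × x < hi

range-between : ∀ i n → All (Between i (i + n)) (range i n)
range-between i zero = []
range-between i (suc n) =
  (≤-refl , m<m+n i z<s)
  ∷ All.map (λ { (l , u) → ≤-trans (n≤1+n i) l , ≤-trans u (≤-reflexive (sym (+-suc i n))) }) (range-between (suc i) n)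

range-unique : ∀ i n → Unique (range i n)
range-unique i zero = []
range-unique i (suc n) =
  All.map (λ { (l , _) e → <-irrefl e l }) (range-between (suc i) n) ∷ range-unique (suc i) n

mutual
  labelsᵗ : ∀ i t → concat (columnsᵗ i t) ↭ range i (sizeᵗ t)
  labelsᵗ i (node ss) = prep i (labelsˢ (suc i) ss)

  labelsˢ : ∀ j ss → columnTail j ss ++ concat (columnsˢ j ss) ↭ range j (sizeˢ ss)
  labelsˢ j [ o ]ˢ = labelsᵒ j o
  labelsˢ j (o ∷ˢ ss) = begin
      x ∷ X ++ concat (columnsᵒ j o ++ columnsˢ j′ ss)
    ≡⟨ cong (λ c → x ∷ X ++ c) (sym (concat-++ (columnsᵒ j o) (columnsˢ j′ ss))) ⟩
      x ∷ X ++ Z ++ Y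
    ≡⟨ cong (x ∷_) (sym (++-assoc X Z Y)) ⟩
      x ∷ (X ++ Z) ++ Y
    ↭⟨ prep x (↭.++⁺ʳ Y (↭.++-comm X Z)) ⟩
      x ∷ (Z ++ X) ++ Y
    ≡⟨ cong (x ∷_) (++-assoc Z X Y) ⟩
      x ∷ Z ++ X ++ Y
    ↭⟨ ↭-sym (↭.shift x Z (X ++ Y)) ⟩
      Z ++ x ∷ X ++ Y
    ↭⟨ ↭.++⁺ (labelsᵒ j o) (prep x (labelsˢ j′ ss)) ⟩
      range j (sizeᵒ o) ++ range x (suc (sizeˢ ss))
    ≡⟨ sym (range-++ j (sizeᵒ o) (suc (sizeˢ ss))) ⟩
      range j (sizeᵒ o + suc (sizeˢ ss)) ∎
    where
    open PermutationReasoning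
    x = j + sizeᵒ o
    j′ = suc x
    X = columnTail j′ ss
    Y = concat (columnsˢ j′ ss)
    Z = concat (columnsᵒ j o)

  labelsᵒ : ∀ j o → concat (columnsᵒ j o) ↭ range j (sizeᵒ o)
  labelsᵒ j empty = ↭-refl
  labelsᵒ j (tree t) = labelsᵗ j t

labelsᵗ-unique : ∀ i t → Unique (concat (columnsᵗ i t))
labelsᵗ-unique i t = Unique-resp-↭ (setoid ℕ) (↭⇒↭ₛ (↭-sym (labelsᵗ i t))) (range-unique i (sizeᵗ t))

labelsᵒ-between : ∀ j o → All (All (Between j (j + sizeᵒ o))) (columnsᵒ j o)
labelsᵒ-between j o = Allₚ.concat⁻ (↭.All-resp-↭ (↭-sym (labelsᵒ j o)) (range-between j (sizeᵒ o)))

open ≡-Reasoning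

data NonEmpty : List ℕ → Set where
  nonEmpty : ∀ {x xs} → NonEmpty (x ∷ xs)

last⇒NonEmpty : ∀ {xs c} → last xs ≡ just c → NonEmpty xs
last⇒NonEmpty {_ ∷ _} _ = nonEmpty

Full⇒NonEmpty : ∀ {ks cols} → Full ks cols → All NonEmpty cols
Full⇒NonEmpty [] = []
Full⇒NonEmpty (_∷_ {y = _ ∷ _} _ f) = nonEmpty ∷ Full⇒NonEmpty f

All-blanks : ∀ {P : ℕ → Set} n → All (All P) (blanks n)
All-blanks zero = []
All-blanks (suc n) = [] ∷ All-blanks n

All²-< : ∀ {m n} → m ≤ n → ∀ {cols} → All (All (_< m)) cols → All (All (_< n)) cols
All²-< m≤n = All.map (All.map (λ x<m → <-≤-trans x<m m≤n))

All²-≢ : ∀ {b} {cols} → All (All (_< b)) cols → All (All (_≢ b)) cols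
All²-≢ = All.map (All.map <⇒≢)

placeS-first-blank : ∀ i pre rest → All NonEmpty pre → placeS i (pre ++ [] ∷ rest) ≡ pre ++ [ i ] ∷ rest
placeS-first-blank i [] rest [] = refl
placeS-first-blank i ((x ∷ xs) ∷ pre) rest (nonEmpty ∷ ne) = cong ((x ∷ xs) ∷_) (placeS-first-blank i pre rest ne)

activeEntry-full : ∀ k col → length col ≡ suc k → activeEntry (suc k) col ≡ nothing
activeEntry-full k (x ∷ xs) e rewrite suc-injective e | <ᵇ-irrefl k = refl

activeEntry-open : ∀ k col b → length col < suc k → last col ≡ just b → activeEntry (suc k) col ≡ just b
activeEntry-open k (x ∷ xs) b (s≤s l) e rewrite <⇒<ᵇ-true l = e

activeEntry-below : ∀ cap col b → All (_< b) col → maxMaybe (activeEntry cap col) (just b) ≡ just b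
activeEntry-below cap [] b _ = refl
activeEntry-below cap (x ∷ xs) b lt with suc (length xs) <ᵇ cap
... | false = refl
... | true with last (x ∷ xs) in e
...   | nothing = refl
...   | just c = cong just (m≤n⇒m⊔n≡n (<⇒≤ (All-last lt e)))

largestActive-below-++ : ∀ caps caps′ pre rest b → length caps ≡ length pre → All (All (_< b)) pre →
  largestActive caps′ rest ≡ just b → largestActive (caps ++ caps′) (pre ++ rest) ≡ just b
largestActive-below-++ [] caps′ [] rest b _ _ e = e
largestActive-below-++ (c ∷ caps) caps′ (col ∷ pre) rest b l (lt ∷ lts) e
  rewrite largestActive-below-++ caps caps′ pre rest b (suc-injective l) lts e = activeEntry-below c col b lt

largestActive-full-++ : ∀ {ks D} caps rest → Full ks D → largestActive caps rest ≡ nothing →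
  largestActive (map suc ks ++ caps) (D ++ rest) ≡ nothing
largestActive-full-++ caps rest [] e = e
largestActive-full-++ {k ∷ _} {col ∷ _} caps rest (l ∷ f) e
  rewrite activeEntry-full k col l = largestActive-full-++ caps rest f e

largestActive-blanks : ∀ caps n → largestActive caps (blanks n) ≡ nothing
largestActive-blanks [] zero = refl
largestActive-blanks [] (suc n) = refl
largestActive-blanks (c ∷ caps) zero = refl
largestActive-blanks (c ∷ caps) (suc n) = largestActive-blanks caps n

placeBelow-skip : ∀ b j col cols → All (_≢ b) col → placeBelow b j (col ∷ cols) ≡ col ∷ placeBelow b j cols
placeBelow-skip b j col cols ne with last col in e
... | nothing = refl
... | just c rewrite ≢⇒≡ᵇ-false (All-last ne e) = refl

placeBelow-absent : ∀ b j cols → All (All (_≢ b)) cols → placeBelow b j cols ≡ cols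
placeBelow-absent b j [] [] = refl
placeBelow-absent b j (col ∷ cols) (ne ∷ nes) =
  trans (placeBelow-skip b j col cols ne) (cong (col ∷_) (placeBelow-absent b j cols nes))

placeBelow-unique : ∀ b j pre col rest → All (All (_≢ b)) pre → last col ≡ just b → All (All (_≢ b)) rest →
  placeBelow b j (pre ++ col ∷ rest) ≡ pre ++ (col ++ [ j ]) ∷ rest
placeBelow-unique b j [] col rest [] e nes rewrite e | ≡ᵇ-refl b = cong ((col ++ [ j ]) ∷_) (placeBelow-absent b j rest nes)
placeBelow-unique b j (p ∷ pre) col rest (ne ∷ nes) e nes′ =
  trans (placeBelow-skip b j p (pre ++ col ∷ rest) ne) (cong (p ∷_) (placeBelow-unique b j pre col rest nes e nes′))

placeW-at : ∀ caps i cols {m} → largestActive caps cols ≡ just m → placeW caps i cols ≡ placeBelow m i cols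
placeW-at caps i cols e rewrite e = refl

-- The only active entry not below b is b itself: the columns after it are full or blank.
placeW-open : ∀ {K} Kp {KD} Kr kv pre col D b j m → K ≡ Kp ++ kv ∷ KD ++ Kr → length Kp ≡ length pre →
  All (All (_< b)) pre → length col < suc kv → last col ≡ just b → Full KD D → All (All (_≢ b)) D →
  placeW (map suc K) j (pre ++ col ∷ D ++ blanks m) ≡ pre ++ (col ++ [ j ]) ∷ D ++ blanks m
placeW-open {K} Kp {KD} Kr kv pre col D b j m eK l lt open-col e f ne =
  trans (placeW-at (map suc K) j _ largest)
        (placeBelow-unique b j pre col (D ++ blanks m) (All²-≢ lt) e (Allₚ.++⁺ ne (All-blanks m)))
  where
  largest : largestActive (map suc K) (pre ++ col ∷ D ++ blanks m) ≡ just b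
  largest rewrite eK | map-++ suc Kp (kv ∷ KD ++ Kr) | map-++ suc KD Kr =
    largestActive-below-++ (map suc Kp) _ pre (col ∷ D ++ blanks m) b (trans (length-map suc Kp) l) lt
      (cong₂ maxMaybe (activeEntry-open kv col b open-col e)
                      (largestActive-full-++ (map suc Kr) (blanks m) f (largestActive-blanks (map suc Kr) m)))

length-++-Full : ∀ Kp pre {KD D} kv (col : List ℕ) → length Kp ≡ length pre → Full KD D →
  length (Kp ++ kv ∷ KD) ≡ length (pre ++ col ∷ D)
length-++-Full Kp pre kv col l f =
  trans (length-++ Kp) (trans (cong₂ _+_ l (cong suc (Pointwise-length f))) (sym (length-++ pre)))

All²-<-suc : ∀ {b} pre col D → All (All (_< b)) pre → All (_≤ b) col → All (All (_< b)) D →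
  All (All (_< suc b)) (pre ++ col ∷ D)
All²-<-suc pre col D lt le ltD = Allₚ.++⁺ (All²-< (n≤1+n _) lt) (All.map s≤s le ∷ All²-< (n≤1+n _) ltD)

-- Invariant while the slots of a node are read: pre holds the columns to the left of
-- the node's column col, whose bottom entry is b; D holds the (complete) columns of
-- the subtrees read so far; blank columns follow.
mutual
  fillFrom-wordᵒ : ∀ K o j pre Kp Kr m rest → K ≡ Kp ++ stepsᵒ o ++ Kr → length Kp ≡ length pre →
    All NonEmpty pre → All (All (_< j)) pre →
    fillFrom K j (wordᵒ o ++ rest) (pre ++ blanks (length (stepsᵒ o) + m))
      ≡ fillFrom K (j + sizeᵒ o) rest (pre ++ columnsᵒ j o ++ blanks m)
  fillFrom-wordᵒ K empty j pre Kp Kr m rest eK l ne lt rewrite +-identityʳ j = refl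
  fillFrom-wordᵒ K (tree t) j pre Kp Kr m rest eK l ne lt = fillFrom-wordᵗ K t j pre Kp Kr m rest eK l ne lt

  fillFrom-wordᵗ : ∀ K t i pre Kp Kr m rest → K ≡ Kp ++ stepsᵗ t ++ Kr → length Kp ≡ length pre →
    All NonEmpty pre → All (All (_< i)) pre →
    fillFrom K i (wordᵗ t ++ rest) (pre ++ blanks (length (stepsᵗ t) + m))
      ≡ fillFrom K (i + sizeᵗ t) rest (pre ++ columnsᵗ i t ++ blanks m)
  fillFrom-wordᵗ K (node ss) i pre Kp Kr m rest eK l ne lt = begin
      fillFrom K (suc i) (wordˢ ss ++ rest) (placeS i (pre ++ [] ∷ blanks (length (stepsˢ ss) + m)))
    ≡⟨ cong (fillFrom K (suc i) (wordˢ ss ++ rest)) (placeS-first-blank i pre _ ne) ⟩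
      fillFrom K (suc i) (wordˢ ss ++ rest) (pre ++ [ i ] ∷ [] ++ blanks (length (stepsˢ ss) + m))
    ≡⟨ fillFrom-wordˢ K ss i [ i ] [] pre Kp (degree ss) [] Kr m rest eK l refl refl (≤-refl ∷ []) [] [] ne lt ⟩
      fillFrom K (suc i + sizeˢ ss) rest (pre ++ columnsᵗ i (node ss) ++ blanks m)
    ≡⟨ cong (λ a → fillFrom K a rest (pre ++ columnsᵗ i (node ss) ++ blanks m)) (sym (+-suc i (sizeˢ ss))) ⟩
      fillFrom K (i + suc (sizeˢ ss)) rest (pre ++ columnsᵗ i (node ss) ++ blanks m) ∎

  fillFrom-slot : ∀ K o b col D pre Kp kv KD Kr m rest →
    K ≡ Kp ++ kv ∷ KD ++ stepsᵒ o ++ Kr → length Kp ≡ length pre → last col ≡ just b → All (_≤ b) col →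
    Full KD D → All (All (_< b)) D → All NonEmpty pre → All (All (_< b)) pre →
    fillFrom K (suc b) (wordᵒ o ++ rest) (pre ++ col ∷ D ++ blanks (length (stepsᵒ o) + m))
      ≡ fillFrom K (suc b + sizeᵒ o) rest (pre ++ col ∷ (D ++ columnsᵒ (suc b) o) ++ blanks m)
  fillFrom-slot K o b col D pre Kp kv KD Kr m rest eK l e le f ltD ne lt = begin
      fillFrom K (suc b) (wordᵒ o ++ rest) (pre ++ col ∷ D ++ blanks (length (stepsᵒ o) + m))
    ≡⟨ cong (fillFrom K (suc b) (wordᵒ o ++ rest)) (sym (++-assoc pre (col ∷ D) _)) ⟩
      fillFrom K (suc b) (wordᵒ o ++ rest) ((pre ++ col ∷ D) ++ blanks (length (stepsᵒ o) + m))
    ≡⟨ fillFrom-wordᵒ K o (suc b) (pre ++ col ∷ D) (Kp ++ kv ∷ KD) Kr m rest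
         (trans eK (sym (++-assoc Kp (kv ∷ KD) (stepsᵒ o ++ Kr))))
         (length-++-Full Kp pre kv col l f)
         (Allₚ.++⁺ ne (last⇒NonEmpty e ∷ Full⇒NonEmpty f))
         (All²-<-suc pre col D lt le ltD) ⟩
      fillFrom K (suc b + sizeᵒ o) rest ((pre ++ col ∷ D) ++ columnsᵒ (suc b) o ++ blanks m)
    ≡⟨ cong (fillFrom K (suc b + sizeᵒ o) rest)
         (trans (++-assoc pre (col ∷ D) _) (cong (λ x → pre ++ col ∷ x) (sym (++-assoc D (columnsᵒ (suc b) o) (blanks m))))) ⟩
      fillFrom K (suc b + sizeᵒ o) rest (pre ++ col ∷ (D ++ columnsᵒ (suc b) o) ++ blanks m) ∎

  fillFrom-wordˢ : ∀ K ss b col D pre Kp kv KD Kr m rest →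
    K ≡ Kp ++ kv ∷ KD ++ stepsˢ ss ++ Kr → length Kp ≡ length pre →
    length col + degree ss ≡ suc kv → last col ≡ just b → All (_≤ b) col →
    Full KD D → All (All (_< b)) D → All NonEmpty pre → All (All (_< b)) pre →
    fillFrom K (suc b) (wordˢ ss ++ rest) (pre ++ col ∷ D ++ blanks (length (stepsˢ ss) + m))
      ≡ fillFrom K (suc b + sizeˢ ss) rest (pre ++ (col ++ columnTail (suc b) ss) ∷ D ++ columnsˢ (suc b) ss ++ blanks m)
  fillFrom-wordˢ K [ o ]ˢ b col D pre Kp kv KD Kr m rest eK l _ e le f ltD ne lt =
    trans (fillFrom-slot K o b col D pre Kp kv KD Kr m rest eK l e le f ltD ne lt)
          (cong (fillFrom K (suc b + sizeᵒ o) rest)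
                (cong₂ (λ c x → pre ++ c ∷ x) (sym (++-identityʳ col)) (++-assoc D (columnsᵒ (suc b) o) (blanks m))))
  fillFrom-wordˢ K (o ∷ˢ ss) b col D pre Kp kv KD Kr m rest eK l lc e le f ltD ne lt = begin
      fillFrom K (suc b) ((wordᵒ o ++ W ∷ wordˢ ss) ++ rest) (pre ++ col ∷ D ++ blanks (length (stepsᵒ o ++ stepsˢ ss) + m))
    ≡⟨ cong₂ (fillFrom K (suc b)) (++-assoc (wordᵒ o) (W ∷ wordˢ ss) rest)
         (cong (λ n → pre ++ col ∷ D ++ blanks n)
               (trans (cong (_+ m) (length-++ (stepsᵒ o))) (+-assoc (length (stepsᵒ o)) _ m))) ⟩
      fillFrom K (suc b) (wordᵒ o ++ W ∷ wordˢ ss ++ rest) (pre ++ col ∷ D ++ blanks (length (stepsᵒ o) + m′))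
    ≡⟨ fillFrom-slot K o b col D pre Kp kv KD (stepsˢ ss ++ Kr) m′ (W ∷ wordˢ ss ++ rest)
         (trans eK (cong (λ x → Kp ++ kv ∷ KD ++ x) (++-assoc (stepsᵒ o) (stepsˢ ss) Kr))) l e le f ltD ne lt ⟩
      fillFrom K (suc j′) (wordˢ ss ++ rest) (placeW (map suc K) j′ (pre ++ col ∷ D′ ++ blanks m′))
    ≡⟨ cong (fillFrom K (suc j′) (wordˢ ss ++ rest))
         (placeW-open Kp (stepsˢ ss ++ Kr) kv pre col D′ b j′ m′ eK′ l lt col-open e fullD′
           (Allₚ.++⁺ (All²-≢ ltD) (All.map (All.map (λ (b<x , _) x≡b → <⇒≢ b<x (sym x≡b))) (labelsᵒ-between (suc b) o)))) ⟩
      fillFrom K (suc j′) (wordˢ ss ++ rest) (pre ++ (col ++ [ j′ ]) ∷ D′ ++ blanks m′)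
    ≡⟨ fillFrom-wordˢ K ss j′ (col ++ [ j′ ]) D′ pre Kp kv KD′ Kr m rest eK′ l lc′ (last-∷ʳ col j′) le′ fullD′ ltD′ ne
         (All²-< b≤j′ lt) ⟩
      fillFrom K (suc j′ + sizeˢ ss) rest (pre ++ ((col ++ [ j′ ]) ++ columnTail (suc j′) ss) ∷ D′ ++ columnsˢ (suc j′) ss ++ blanks m)
    ≡⟨ cong₂ (λ a c → fillFrom K a rest c) (size-shift (suc b) (sizeᵒ o) (sizeˢ ss))
         (cong₂ (λ c r → pre ++ c ∷ r) (++-assoc col [ j′ ] _)
                (trans (++-assoc D (columnsᵒ (suc b) o) _)
                       (cong (D ++_) (sym (++-assoc (columnsᵒ (suc b) o) (columnsˢ (suc j′) ss) (blanks m)))))) ⟩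
      fillFrom K (suc b + (sizeᵒ o + suc (sizeˢ ss))) rest
        (pre ++ (col ++ j′ ∷ columnTail (suc j′) ss) ∷ D ++ (columnsᵒ (suc b) o ++ columnsˢ (suc j′) ss) ++ blanks m) ∎
    where
    j′ = suc b + sizeᵒ o
    m′ = length (stepsˢ ss) + m
    D′ = D ++ columnsᵒ (suc b) o
    KD′ = KD ++ stepsᵒ o
    b≤j′ : b ≤ j′
    b≤j′ = ≤-trans (n≤1+n b) (m≤m+n (suc b) (sizeᵒ o))
    size-shift : ∀ j a s → suc (j + a) + s ≡ j + (a + suc s)
    size-shift j a s = trans (cong (_+ s) (sym (+-suc j a))) (trans (+-assoc j (suc a) s) (cong (j +_) (sym (+-suc a s))))
    eK′ : K ≡ Kp ++ kv ∷ KD′ ++ stepsˢ ss ++ Kr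
    eK′ = trans eK (cong (λ x → Kp ++ kv ∷ x)
            (trans (cong (KD ++_) (++-assoc (stepsᵒ o) (stepsˢ ss) Kr)) (sym (++-assoc KD (stepsᵒ o) (stepsˢ ss ++ Kr)))))
    fullD′ : Full KD′ D′
    fullD′ = Pointwise.++⁺ f (full-columnsᵒ (suc b) o)
    ltD′ : All (All (_< j′)) D′
    ltD′ = Allₚ.++⁺ (All²-< b≤j′ ltD) (All.map (All.map proj₂) (labelsᵒ-between (suc b) o))
    le′ : All (_≤ j′) (col ++ [ j′ ])
    le′ = Allₚ.++⁺ (All.map (λ x≤b → ≤-trans x≤b b≤j′) le) (≤-refl ∷ [])
    lc′ : length (col ++ [ j′ ]) + degree ss ≡ suc kv
    lc′ = trans (cong (_+ degree ss) (length-++ col)) (trans (+-assoc (length col) 1 (degree ss)) lc)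
    col-open : length col < suc kv
    col-open = ≤-trans (s≤s (m≤m+n (length col) (degree ss))) (≤-reflexive (trans (sym (+-suc (length col) (degree ss))) lc))

fill-wordᵗ : ∀ t → fill (stepsᵗ t) (wordᵗ t) ≡ columnsᵗ 1 t
fill-wordᵗ t = begin
    fill (stepsᵗ t) (wordᵗ t)
  ≡⟨ fill≡fillFrom (stepsᵗ t) (wordᵗ t) ⟩
    fillFrom (stepsᵗ t) 1 (wordᵗ t) (blanks (length (stepsᵗ t)))
  ≡⟨ cong₂ (fillFrom (stepsᵗ t) 1) (sym (++-identityʳ (wordᵗ t))) (cong blanks (sym (+-identityʳ (length (stepsᵗ t))))) ⟩
    fillFrom (stepsᵗ t) 1 (wordᵗ t ++ []) ([] ++ blanks (length (stepsᵗ t) + 0))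
  ≡⟨ fillFrom-wordᵗ (stepsᵗ t) t 1 [] [] [] 0 [] (sym (++-identityʳ (stepsᵗ t))) refl [] [] ⟩
    fillFrom (stepsᵗ t) (1 + sizeᵗ t) [] (columnsᵗ 1 t ++ [])
  ≡⟨ ++-identityʳ (columnsᵗ 1 t) ⟩
    columnsᵗ 1 t ∎

-- Ranks of the tableau of a tree

locateInColumn-skip : ∀ A F c r col cols → All (_≢ A) col → locateInColumn A F c r col cols ≡ locateFrom A F (suc c) cols
locateInColumn-skip A F c r [] cols [] = refl
locateInColumn-skip A F c r (y ∷ ys) cols (y≢A ∷ ne) rewrite ≢⇒≡ᵇ-false y≢A = locateInColumn-skip A F c (suc r) ys cols ne

locateInColumn-hit : ∀ A F c r ca cb cols → All (_≢ A) ca → locateInColumn A F c r (ca ++ A ∷ cb) cols ≡ just (c , r + length ca)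
locateInColumn-hit A F c r [] cb cols [] rewrite ≡ᵇ-refl A | +-identityʳ r = refl
locateInColumn-hit A F c r (y ∷ ca) cb cols (y≢A ∷ ne) rewrite ≢⇒≡ᵇ-false y≢A | +-suc r (length ca) =
  locateInColumn-hit A F c (suc r) ca cb cols ne

locateFrom-skip : ∀ A F c Fa rest → All (All (_≢ A)) Fa → locateFrom A F c (Fa ++ rest) ≡ locateFrom A F (c + length Fa) rest
locateFrom-skip A F c [] rest [] rewrite +-identityʳ c = refl
locateFrom-skip A F c (col ∷ Fa) rest (ne ∷ nes) rewrite +-suc c (length Fa) =
  trans (locateInColumn-skip A F c 0 col (Fa ++ rest) ne) (locateFrom-skip A F (suc c) Fa rest nes)

locate-unique : ∀ A F Fa ca cb Fb → F ≡ Fa ++ (ca ++ A ∷ cb) ∷ Fb → Unique (concat F) →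
  locate A F ≡ just (length Fa , length ca)
locate-unique A F Fa ca cb Fb eF u = begin
    locate A F
  ≡⟨⟩
    locateFrom A F 0 F
  ≡⟨ cong (locateFrom A F 0) eF ⟩
    locateFrom A F 0 (Fa ++ (ca ++ A ∷ cb) ∷ Fb)
  ≡⟨ locateFrom-skip A F 0 Fa _ (Allₚ.concat⁻ (Allₚ.++⁻ˡ (concat Fa) ne)) ⟩
    locateInColumn A F (length Fa) 0 (ca ++ A ∷ cb) Fb
  ≡⟨ locateInColumn-hit A F (length Fa) 0 ca cb Fb (Allₚ.++⁻ʳ (concat Fa) ne) ⟩
    just (length Fa , length ca) ∎
  where
  concat-F : concat F ≡ (concat Fa ++ ca) ++ A ∷ (cb ++ concat Fb)
  concat-F = begin
      concat F
    ≡⟨ cong concat eF ⟩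
      concat (Fa ++ (ca ++ A ∷ cb) ∷ Fb)
    ≡⟨ sym (concat-++ Fa ((ca ++ A ∷ cb) ∷ Fb)) ⟩
      concat Fa ++ (ca ++ A ∷ cb) ++ concat Fb
    ≡⟨ cong (concat Fa ++_) (++-assoc ca (A ∷ cb) (concat Fb)) ⟩
      concat Fa ++ ca ++ A ∷ (cb ++ concat Fb)
    ≡⟨ sym (++-assoc (concat Fa) ca _) ⟩
      (concat Fa ++ ca) ++ A ∷ (cb ++ concat Fb) ∎
  ne : All (_≢ A) (concat Fa ++ ca)
  ne = Unique-++-∷ (concat Fa ++ ca) A _ (subst Unique concat-F u)

topRanksFrom-step : ∀ F x rest cols a as c r → locate x F ≡ just (c , r) →
  topRanksFrom F ((suc x ∷ rest) ∷ cols) (a ∷ as) ≡ topRanksFrom F cols ((a ∷ as) ++ [ nth (a ∷ as) c + r ])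
topRanksFrom-step F x rest cols a as c r e rewrite e = refl

nth-++ˡ : ∀ (xs ys : List ℕ) i → i < length xs → nth (xs ++ ys) i ≡ nth xs i
nth-++ˡ (x ∷ xs) ys zero _ = refl
nth-++ˡ (x ∷ xs) ys (suc i) (s<s i<) = nth-++ˡ xs ys i i<

nth-++-length : ∀ (xs : List ℕ) y ys → nth (xs ++ y ∷ ys) (length xs) ≡ y
nth-++-length [] y ys = refl
nth-++-length (x ∷ xs) y ys = nth-++-length xs y ys

mutual
  length-depthSeqᵗ : ∀ r i t → length (depthSeqᵗ r t) ≡ length (columnsᵗ i t)
  length-depthSeqᵗ r i (node ss) = cong suc (length-depthSeqˢ r (suc i) ss)

  length-depthSeqˢ : ∀ r j ss → length (depthSeqˢ r ss) ≡ length (columnsˢ j ss)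
  length-depthSeqˢ r j [ o ]ˢ = length-depthSeqᵒ r j o
  length-depthSeqˢ r j (o ∷ˢ ss) =
    trans (length-++ (depthSeqᵒ r o))
          (trans (cong₂ _+_ (length-depthSeqᵒ r j o) (length-depthSeqˢ (suc r) _ ss)) (sym (length-++ (columnsᵒ j o))))

  length-depthSeqᵒ : ∀ r j o → length (depthSeqᵒ r o) ≡ length (columnsᵒ j o)
  length-depthSeqᵒ r j empty = refl
  length-depthSeqᵒ r j (tree t) = length-depthSeqᵗ r j t

0<length : ∀ {αs : List ℕ} {a b} → length αs ≡ a + suc b → 0 < length αs
0<length {a = a} {b} e rewrite e | +-suc a b = z<s

-- While the columns of the slots of a node are ranked: the node's column sits at
-- index length Fpre of F with top rank r, and cd ++ [ x ] are its entries down to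
-- the one preceding the current slot.
mutual
  topRanksFrom-columnsᵗ : ∀ F t x Fpre rest a as c g r → F ≡ Fpre ++ columnsᵗ (suc x) t ++ rest →
    length Fpre ≡ length (a ∷ as) → locate x F ≡ just (c , g) → nth (a ∷ as) c + g ≡ r → Unique (concat F) →
    topRanksFrom F (columnsᵗ (suc x) t ++ rest) (a ∷ as) ≡ topRanksFrom F rest ((a ∷ as) ++ depthSeqᵗ r t)
  topRanksFrom-columnsᵗ F (node ss) x Fpre rest a as c g r eF l loc en u = begin
      topRanksFrom F ((suc x ∷ columnTail (suc (suc x)) ss) ∷ columnsˢ (suc (suc x)) ss ++ rest) (a ∷ as)
    ≡⟨ topRanksFrom-step F x (columnTail (suc (suc x)) ss) (columnsˢ (suc (suc x)) ss ++ rest) a as c g loc ⟩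
      topRanksFrom F (columnsˢ (suc (suc x)) ss ++ rest) ((a ∷ as) ++ [ nth (a ∷ as) c + g ])
    ≡⟨ cong (λ v → topRanksFrom F (columnsˢ (suc (suc x)) ss ++ rest) ((a ∷ as) ++ [ v ])) en ⟩
      topRanksFrom F (columnsˢ (suc (suc x)) ss ++ rest) ((a ∷ as) ++ [ r ])
    ≡⟨ topRanksFrom-columnsˢ F ss (suc x) [] r Fpre [] rest ((a ∷ as) ++ [ r ]) eF
         (trans (length-++ (a ∷ as)) (cong (_+ 1) (sym l)))
         (trans (cong (nth ((a ∷ as) ++ [ r ])) l) (nth-++-length (a ∷ as) r [])) u ⟩
      topRanksFrom F rest (((a ∷ as) ++ [ r ]) ++ depthSeqˢ (r + 0) ss)
    ≡⟨ cong (topRanksFrom F rest)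
         (trans (++-assoc (a ∷ as) [ r ] _) (cong (λ v → (a ∷ as) ++ r ∷ depthSeqˢ v ss) (+-identityʳ r))) ⟩
      topRanksFrom F rest ((a ∷ as) ++ r ∷ depthSeqˢ r ss) ∎

  topRanksFrom-columnsˢ : ∀ F ss x cd r Fpre Dc rest αs →
    F ≡ Fpre ++ (cd ++ x ∷ columnTail (suc x) ss) ∷ (Dc ++ columnsˢ (suc x) ss ++ rest) →
    length αs ≡ length Fpre + suc (length Dc) → nth αs (length Fpre) ≡ r → Unique (concat F) →
    topRanksFrom F (columnsˢ (suc x) ss ++ rest) αs ≡ topRanksFrom F rest (αs ++ depthSeqˢ (r + length cd) ss)
  topRanksFrom-columnsˢ F [ o ]ˢ x cd r Fpre Dc rest αs eF l en u =
    topRanksFrom-columnsᵒ F o x (Fpre ++ (cd ++ x ∷ []) ∷ Dc) rest αs (length Fpre) (length cd) (r + length cd)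
      (trans eF (sym (++-assoc Fpre ((cd ++ x ∷ []) ∷ Dc) _)))
      (trans (length-++ Fpre) (sym l)) (0<length {αs} l)
      (locate-unique x F Fpre cd [] (Dc ++ columnsᵒ (suc x) o ++ rest) eF u)
      (cong (_+ length cd) en) u
  topRanksFrom-columnsˢ F (o ∷ˢ ss) x cd r Fpre Dc rest αs eF l en u = begin
      topRanksFrom F ((columnsᵒ (suc x) o ++ columnsˢ x′ ss) ++ rest) αs
    ≡⟨ cong (λ c → topRanksFrom F c αs) (++-assoc (columnsᵒ (suc x) o) _ rest) ⟩
      topRanksFrom F (columnsᵒ (suc x) o ++ columnsˢ x′ ss ++ rest) αs
    ≡⟨ topRanksFrom-columnsᵒ F o x (Fpre ++ col ∷ Dc) (columnsˢ x′ ss ++ rest) αs (length Fpre) (length cd) (r + length cd)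
         (trans eF (trans (cong (λ c → Fpre ++ col ∷ c) (cong (Dc ++_) (++-assoc (columnsᵒ (suc x) o) _ rest)))
                          (sym (++-assoc Fpre (col ∷ Dc) _))))
         (trans (length-++ Fpre) (sym l)) (0<length {αs} l)
         (locate-unique x F Fpre cd _ (Dc ++ columnsˢ (suc x) (o ∷ˢ ss) ++ rest) eF u)
         (cong (_+ length cd) en) u ⟩
      topRanksFrom F (columnsˢ x′ ss ++ rest) (αs ++ depthSeqᵒ (r + length cd) o)
    ≡⟨ topRanksFrom-columnsˢ F ss (suc x + sizeᵒ o) (cd ++ [ x ]) r Fpre (Dc ++ columnsᵒ (suc x) o) rest
         (αs ++ depthSeqᵒ (r + length cd) o) eF′ l′ en′ u ⟩
      topRanksFrom F rest ((αs ++ depthSeqᵒ (r + length cd) o) ++ depthSeqˢ (r + length (cd ++ [ x ])) ss)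
    ≡⟨ cong (topRanksFrom F rest)
         (trans (++-assoc αs _ _) (cong (λ v → αs ++ depthSeqᵒ (r + length cd) o ++ depthSeqˢ v ss) next-row)) ⟩
      topRanksFrom F rest (αs ++ depthSeqᵒ (r + length cd) o ++ depthSeqˢ (suc (r + length cd)) ss) ∎
    where
    x′ = suc (suc x + sizeᵒ o)
    col = cd ++ x ∷ columnTail (suc x) (o ∷ˢ ss)
    next-row : r + length (cd ++ [ x ]) ≡ suc (r + length cd)
    next-row = trans (cong (r +_) (trans (length-++ cd) (+-comm (length cd) 1))) (+-suc r (length cd))
    eF′ : F ≡ Fpre ++ ((cd ++ [ x ]) ++ (suc x + sizeᵒ o) ∷ columnTail x′ ss) ∷ ((Dc ++ columnsᵒ (suc x) o) ++ columnsˢ x′ ss ++ rest)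
    eF′ = trans eF (cong₂ (λ c d → Fpre ++ c ∷ d) (sym (++-assoc cd [ x ] _))
            (trans (cong (Dc ++_) (++-assoc (columnsᵒ (suc x) o) _ rest)) (sym (++-assoc Dc (columnsᵒ (suc x) o) _))))
    l′ : length (αs ++ depthSeqᵒ (r + length cd) o) ≡ length Fpre + suc (length (Dc ++ columnsᵒ (suc x) o))
    l′ = begin
        length (αs ++ depthSeqᵒ (r + length cd) o)
      ≡⟨ length-++ αs ⟩
        length αs + length (depthSeqᵒ (r + length cd) o)
      ≡⟨ cong₂ _+_ l (length-depthSeqᵒ _ (suc x) o) ⟩
        (length Fpre + suc (length Dc)) + length (columnsᵒ (suc x) o)
      ≡⟨ +-assoc (length Fpre) _ _ ⟩
        length Fpre + suc (length Dc + length (columnsᵒ (suc x) o))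
      ≡⟨ cong (λ v → length Fpre + suc v) (sym (length-++ Dc)) ⟩
        length Fpre + suc (length (Dc ++ columnsᵒ (suc x) o)) ∎
    en′ : nth (αs ++ depthSeqᵒ (r + length cd) o) (length Fpre) ≡ r
    en′ = trans (nth-++ˡ αs _ (length Fpre)
                  (≤-trans (s≤s (m≤m+n (length Fpre) (length Dc)))
                           (≤-reflexive (trans (sym (+-suc (length Fpre) (length Dc))) (sym l)))))
                en

  topRanksFrom-columnsᵒ : ∀ F o x Fpre rest αs c g r → F ≡ Fpre ++ columnsᵒ (suc x) o ++ rest →
    length Fpre ≡ length αs → 0 < length αs → locate x F ≡ just (c , g) → nth αs c + g ≡ r → Unique (concat F) →
    topRanksFrom F (columnsᵒ (suc x) o ++ rest) αs ≡ topRanksFrom F rest (αs ++ depthSeqᵒ r o)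
  topRanksFrom-columnsᵒ F empty x Fpre rest αs c g r _ _ _ _ _ _ = cong (topRanksFrom F rest) (sym (++-identityʳ αs))
  topRanksFrom-columnsᵒ F (tree t) x Fpre rest (a ∷ as) c g r eF l _ loc en u =
    topRanksFrom-columnsᵗ F t x Fpre rest a as c g r eF l loc en u

topRanks-columnsᵗ : ∀ t → topRanks (columnsᵗ 1 t) ≡ depthSeqᵗ 0 t
topRanks-columnsᵗ (node ss) = begin
    topRanks F
  ≡⟨ topRanks≡topRanksFrom (1 ∷ columnTail 2 ss) (columnsˢ 2 ss) ⟩
    topRanksFrom F (columnsˢ 2 ss) [ 0 ]
  ≡⟨ cong (λ c → topRanksFrom F c [ 0 ]) (sym (++-identityʳ (columnsˢ 2 ss))) ⟩
    topRanksFrom F (columnsˢ 2 ss ++ []) [ 0 ]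
  ≡⟨ topRanksFrom-columnsˢ F ss 1 [] 0 [] [] [] [ 0 ]
       (cong ((1 ∷ columnTail 2 ss) ∷_) (sym (++-identityʳ (columnsˢ 2 ss)))) refl refl (labelsᵗ-unique 1 (node ss)) ⟩
    0 ∷ depthSeqˢ 0 ss ∎
  where
  F = columnsᵗ 1 (node ss)

depthSeq-wordᵒ : ∀ o → depthSeq (stepsᵒ o) (wordᵒ o) ≡ depthSeqᵒ 0 o
depthSeq-wordᵒ empty = refl
depthSeq-wordᵒ (tree t) = trans (cong topRanks (fill-wordᵗ t)) (topRanks-columnsᵗ t)

-- The mirror involution on paths

pathOf : Slot → DPath
pathOf o = stepsᵒ o , wordᵒ o

mirrorPathWith : ∀ ks w → Dec (IsDyck ks w) → DPath
mirrorPathWith ks w (yes d) = pathOf (mirrorᵒ (proj₁ (parse d)))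
mirrorPathWith ks w (no _) = ks , w

-- Pairs that are not Dyck paths are fixed, so that mirrorPath is an involution of DPath.
mirrorPath : DPath → DPath
mirrorPath (ks , w) = mirrorPathWith ks w (isDyck? ks w)

mirrorPath-pathOf : ∀ o → mirrorPath (pathOf o) ≡ pathOf (mirrorᵒ o)
mirrorPath-pathOf o with isDyck? (stepsᵒ o) (wordᵒ o)
... | no ¬d = ⊥-elim (¬d (IsDyck-wordᵒ o))
... | yes d with parse d
...   | o′ , eks , ew rewrite wordᵒ-injective o′ o eks ew = refl

mirrorPath-fixed : ∀ {ks w} → ¬ IsDyck ks w → mirrorPath (ks , w) ≡ (ks , w)
mirrorPath-fixed {ks} {w} ¬d with isDyck? ks w
... | yes d = ⊥-elim (¬d d)
... | no _ = refl

mirrorPath-involutive : ∀ p → mirrorPath (mirrorPath p) ≡ p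
mirrorPath-involutive (ks , w) with isDyck? ks w
... | no ¬d = mirrorPath-fixed ¬d
... | yes d with parse d
...   | o , refl , refl = trans (mirrorPath-pathOf (mirrorᵒ o)) (cong pathOf (mirrorᵒ-involutive o))

areaᴾ depthᴾ : DPath → ℕ
areaᴾ p = area (proj₁ p) (proj₂ p)
depthᴾ p = depth (proj₁ p) (proj₂ p)

area-mirrorᵒ : ∀ o → areaᴾ (pathOf (mirrorᵒ o)) ≡ depthᴾ (pathOf o)
area-mirrorᵒ o = begin
    sum (areaSeq (stepsᵒ (mirrorᵒ o)) (wordᵒ (mirrorᵒ o)))
  ≡⟨ cong sum (areaSeq-wordᵒ (mirrorᵒ o)) ⟩
    sum (areaSeqᵒ 0 (mirrorᵒ o))
  ≡⟨ sum-↭ (areaSeq-mirrorᵒ 0 o) ⟩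
    sum (depthSeqᵒ 0 o)
  ≡⟨ cong sum (depthSeq-wordᵒ o) ⟨
    sum (depthSeq (stepsᵒ o) (wordᵒ o)) ∎

depth-mirrorᵒ : ∀ o → depthᴾ (pathOf (mirrorᵒ o)) ≡ areaᴾ (pathOf o)
depth-mirrorᵒ o = begin
    sum (depthSeq (stepsᵒ (mirrorᵒ o)) (wordᵒ (mirrorᵒ o)))
  ≡⟨ cong sum (depthSeq-wordᵒ (mirrorᵒ o)) ⟩
    sum (depthSeqᵒ 0 (mirrorᵒ o))
  ≡⟨ sum-↭ (areaSeq-mirrorᵒ 0 (mirrorᵒ o)) ⟨
    sum (areaSeqᵒ 0 (mirrorᵒ (mirrorᵒ o)))
  ≡⟨ cong (λ o′ → sum (areaSeqᵒ 0 o′)) (mirrorᵒ-involutive o) ⟩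
    sum (areaSeqᵒ 0 o)
  ≡⟨ cong sum (areaSeq-wordᵒ o) ⟨
    sum (areaSeq (stepsᵒ o) (wordᵒ o)) ∎

mirrorPath-swaps : ∀ {ks w} → IsDyck ks w →
  areaᴾ (mirrorPath (ks , w)) ≡ depth ks w × depthᴾ (mirrorPath (ks , w)) ≡ area ks w
mirrorPath-swaps d with parse d
... | o , refl , refl rewrite mirrorPath-pathOf o = area-mirrorᵒ o , depth-mirrorᵒ o

IsDyck-mirrorPath : ∀ {ks w} → IsDyck ks w → IsDyck (proj₁ (mirrorPath (ks , w))) (proj₂ (mirrorPath (ks , w)))
IsDyck-mirrorPath d with parse d
... | o , refl , refl rewrite mirrorPath-pathOf o = IsDyck-wordᵒ (mirrorᵒ o)

steps-mirrorPath : ∀ {a js w} → IsDyck (a ∷ js) w →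
  Σ (List ℕ) λ js′ → proj₁ (mirrorPath (a ∷ js , w)) ≡ a ∷ js′ × js′ ↭ js
steps-mirrorPath d with parse d
... | tree (node ss) , refl , refl rewrite mirrorPath-pathOf (tree (node ss)) =
  stepsˢ (mirrorˢ ss) , cong (_∷ stepsˢ (mirrorˢ ss)) (degree-mirror ss) , steps-mirrorˢ ss

-- Enumeration of 𝒟_{^a𝒦}

∈-allWords : ∀ w → w ∈ allWords (length w)
∈-allWords [] = here refl
∈-allWords (S ∷ w) = ∈-concat⁺′ (here refl) (∈-map⁺ _ (∈-allWords w))
∈-allWords (W ∷ w) = ∈-concat⁺′ (there (here refl)) (∈-map⁺ _ (∈-allWords w))

length≡countW+countS : ∀ w → length w ≡ countW w + countS w
length≡countW+countS [] = refl
length≡countW+countS (S ∷ w) = trans (cong suc (length≡countW+countS w)) (sym (+-suc (countW w) (countS w)))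
length≡countW+countS (W ∷ w) = cong suc (length≡countW+countS w)

∈-Dyck⁺ : ∀ {ks w} → IsDyck ks w → w ∈ Dyck ks
∈-Dyck⁺ {ks} {w} d@(cS , cW , _) =
  ∈-filter⁺ (isDyck? ks) (subst (λ n → w ∈ allWords n) (trans (length≡countW+countS w) (cong₂ _+_ cW cS)) (∈-allWords w)) d

∈-Dyck⁻ : ∀ {ks w} → w ∈ Dyck ks → IsDyck ks w
∈-Dyck⁻ {ks} m = proj₂ (∈-filter⁻ (isDyck? ks) {xs = allWords (sum ks + length ks)} m)

∈-DyckSet⁺ : ∀ {𝒮 ks w} → ks ∈ 𝒮 → IsDyck ks w → (ks , w) ∈ DyckSet 𝒮
∈-DyckSet⁺ {ks = ks} m d = ∈-concat⁺′ (∈-map⁺ (ks ,_) (∈-Dyck⁺ d)) (∈-map⁺ (λ js → map (js ,_) (Dyck js)) m)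

∈-DyckSet⁻ : ∀ {𝒮 p} → p ∈ DyckSet 𝒮 → proj₁ p ∈ 𝒮 × IsDyck (proj₁ p) (proj₂ p)
∈-DyckSet⁻ {𝒮} m with ∈-concat⁻′ (map (λ js → map (js ,_) (Dyck js)) 𝒮) m
... | _ , m₁ , m₂ with ∈-map⁻ (λ js → map (js ,_) (Dyck js)) m₂
... | ks , m₃ , refl with ∈-map⁻ (ks ,_) m₁
... | w , m₄ , refl = m₃ , ∈-Dyck⁻ m₄

∈-insertions⁻ : ∀ x ys {zs} → zs ∈ insertions x ys → zs ↭ x ∷ ys
∈-insertions⁻ x [] (here refl) = ↭-refl
∈-insertions⁻ x (y ∷ ys) (here refl) = ↭-refl
∈-insertions⁻ x (y ∷ ys) (there m) with ∈-map⁻ (y ∷_) m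
... | zs , m′ , refl = ↭-trans (prep y (∈-insertions⁻ x ys m′)) (swap y x ↭-refl)

∈-insertions⁺ : ∀ x u v → u ++ x ∷ v ∈ insertions x (u ++ v)
∈-insertions⁺ x [] [] = here refl
∈-insertions⁺ x [] (y ∷ v) = here refl
∈-insertions⁺ x (y ∷ u) v = there (∈-map⁺ (y ∷_) (∈-insertions⁺ x u v))

∈-permutations⁻ : ∀ xs {zs} → zs ∈ permutations xs → zs ↭ xs
∈-permutations⁻ [] (here refl) = ↭-refl
∈-permutations⁻ (x ∷ xs) m with ∈-concat⁻′ (map (insertions x) (permutations xs)) m
... | _ , m₁ , m₂ with ∈-map⁻ (insertions x) m₂
... | ys , m₃ , refl = ↭-trans (∈-insertions⁻ x ys m₁) (prep x (∈-permutations⁻ xs m₃))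

∈-permutations⁺ : ∀ xs {zs} → zs ↭ xs → zs ∈ permutations xs
∈-permutations⁺ [] p rewrite ↭.↭-empty-inv p = here refl
∈-permutations⁺ (x ∷ xs) p with ∈-∃++ (↭.∈-resp-↭ (↭-sym p) (here refl))
... | u , v , refl = ∈-concat⁺′ (∈-insertions⁺ x u v) (∈-map⁺ (insertions x) (∈-permutations⁺ xs (↭.drop-mid u [] p)))

∈-prefixK⁺ : ∀ a {ks js} → js ↭ ks → a ∷ js ∈ prefixK a ks
∈-prefixK⁺ a {ks} p = ∈-map⁺ (a ∷_) (∈-deduplicate⁺ (≡-dec _≟_) (∈-permutations⁺ ks p))

∈-prefixK⁻ : ∀ a ks {js} → js ∈ prefixK a ks → Σ (List ℕ) λ js′ → js ≡ a ∷ js′ × js′ ↭ ks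
∈-prefixK⁻ a ks m with ∈-map⁻ (a ∷_) m
... | js′ , m′ , refl = js′ , refl , ∈-permutations⁻ ks (∈-deduplicate⁻ (≡-dec _≟_) (permutations ks) m′)

mirrorPath-∈ : ∀ a ks {p} → p ∈ DyckSet (prefixK a ks) → mirrorPath p ∈ DyckSet (prefixK a ks)
mirrorPath-∈ a ks {js , w} m with ∈-DyckSet⁻ m
... | mj , d with ∈-prefixK⁻ a ks mj
... | js′ , refl , p with steps-mirrorPath d
... | _ , e , p′ = ∈-DyckSet⁺ (subst (_∈ prefixK a ks) (sym e) (∈-prefixK⁺ a (↭-trans p′ p))) (IsDyck-mirrorPath d)

Unique-allWords : ∀ n → Unique (allWords n)
Unique-allWords zero = [] ∷ []
Unique-allWords (suc n) = Unique-concatMap (λ w → (S ∷ w) ∷ (W ∷ w) ∷ []) (Unique-allWords n)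
  (λ w → ((λ ()) ∷ []) ∷ [] ∷ []) disj
  where
  disj : ∀ {x y z} → z ∈ (S ∷ x) ∷ (W ∷ x) ∷ [] → z ∈ (S ∷ y) ∷ (W ∷ y) ∷ [] → x ≡ y
  disj (here refl) (here refl) = refl
  disj (there (here refl)) (there (here refl)) = refl
  disj (here refl) (there (here ()))
  disj (there (here refl)) (here ())
  disj (here refl) (there (there ()))
  disj (there (here refl)) (there (there ()))

Unique-DyckSet : ∀ {𝒮} → Unique 𝒮 → Unique (DyckSet 𝒮)
Unique-DyckSet u = Unique-concatMap (λ js → map (js ,_) (Dyck js)) u
  (λ js → Unique.map⁺ (cong proj₂) (Unique.filter⁺ (isDyck? js) (Unique-allWords (sum js + length js))))
  disj
  where
  disj : ∀ {x y} {z : DPath} → z ∈ map (x ,_) (Dyck x) → z ∈ map (y ,_) (Dyck y) → x ≡ y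
  disj m₁ m₂ with ∈-map⁻ _ m₁ | ∈-map⁻ _ m₂
  ... | _ , _ , refl | _ , _ , refl = refl

Unique-prefixK : ∀ a ks → Unique (prefixK a ks)
Unique-prefixK a ks = Unique.map⁺ ∷-injectiveʳ (deduplicate-! (permutations ks))

theorem1p1 : (ks : List ℕ) → All (0 <_) ks → (a : ℕ) → 0 < a →
    QTSymmetric (Ctilde (prefixK a ks))
theorem1p1 ks _ a _ i j =
  length-filter-involution mirrorPath mirrorPath-involutive (Unique-DyckSet (Unique-prefixK a ks)) (mirrorPath-∈ a ks)
    (λ p → (areaᴾ p ≟ i) ×-dec (depthᴾ p ≟ j)) (λ p → (areaᴾ p ≟ j) ×-dec (depthᴾ p ≟ i)) swapped
  where
  swapped : ∀ {p} → p ∈ DyckSet (prefixK a ks) →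
    (areaᴾ (mirrorPath p) ≡ i × depthᴾ (mirrorPath p) ≡ j) ⇔ (areaᴾ p ≡ j × depthᴾ p ≡ i)
  swapped m with mirrorPath-swaps (proj₂ (∈-DyckSet⁻ {prefixK a ks} m))
  ... | area≡ , depth≡ = mk⇔ (λ (a≡i , d≡j) → trans (sym depth≡) d≡j , trans (sym area≡) a≡i)
                             (λ (a≡j , d≡i) → trans area≡ d≡i , trans depth≡ a≡j)
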